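{- The set $I=\{x\in\mathbb N:\min(K(x),K_{\max}(x),K_{\min}(x))\ge\lfloor\log(x)\rfloor-1\}$ is infinite and is definable by a formula of the form $\forall^{\le\log}(A\wedge B)$ where $A,B$ are $\Sigma^0_1\vee\Pi^0_1$. In particular, $I$ is $\Delta^0_2$.
   Context: For a partial $f:\{0,1\}^*\to\mathbb N$, $K_f(x)=\min\{|p|:f(p)=x\}$. $Min_{PR}(\{0,1\}^*\to\mathbb N)$ (resp. $Max_{PR}$) is the family of $p\mapsto\min\{\varphi(p,t):\varphi(p,t)\text{ defined}\}$ (resp. max; empty min/max and infinite max undefined) for partial recursive $\varphi$. $K=K_U$ for a fixed optimal partial recursive $U$; $K_{\min}$ (resp. $K_{\max}$) $=K_V$ for a fixed $V$ optimal in $Min_{PR}$ (resp. $Max_{PR}$), optimal meaning $K_V\le K_W+c_W$ for every $W$ in the family. $\log$ is base 2. A set is definable by $\forall^{\le\log}(A\wedge B)$ if there are $n$ and $A,B\subseteq\mathbb N\times(\{0,1\}^*)^n$, each the union of an r.e. set and a co-r.e. set, with the set equal to $\{x:\forall v_1..v_n\,(\forall l\ |v_l|\le\log x)\ (x,\vec v)\in A\cap B\}$. -}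

module Defs where

open import Level using (0ℓ)
open import Data.Nat using (ℕ; zero; suc; _+_; _*_; _∸_; _≤_; _<_)
open import Data.Nat.Logarithm using (⌊log₂_⌋)
open import Data.Bool using (Bool; true; false)
open import Data.List using (List; []; _∷_; length)
open import Data.Fin using (Fin)
open import Data.Vec using (Vec; []; _∷_; lookup)
import Data.Vec as Vec
open import Data.Vec.Relation.Unary.All using (All)
open import Data.Product using (Σ; ∃; _×_; _,_)
open import Data.Sum using (_⊎_)
open import Relation.Nullary using (¬_)
open import Function.Bundles using (_⇔_)

-- Partial recursive functions: mu-recursive codes with relational
-- (big-step) semantics.  Eval c xs y  means  "c(xs) is defined and = y".

data Code : ℕ → Set where
  cz  : ∀ {k} → Code k
  cs  : Code 1
  cp  : ∀ {k} → Fin k → Code k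
  cc  : ∀ {k m} → Code m → Vec (Code k) m → Code k
  cr  : ∀ {k} → Code k → Code (suc (suc k)) → Code (suc k)
  cmu : ∀ {k} → Code (suc k) → Code k

mutual
  data Eval : ∀ {k} → Code k → Vec ℕ k → ℕ → Set where
    ev-z  : ∀ {k} {xs : Vec ℕ k} → Eval cz xs 0
    ev-s  : ∀ {x} → Eval cs (x ∷ []) (suc x)
    ev-p  : ∀ {k} {i : Fin k} {xs} → Eval (cp i) xs (lookup xs i)
    ev-c  : ∀ {k m} {f : Code m} {gs : Vec (Code k) m} {xs ys y} →
            EvalAll gs xs ys → Eval f ys y → Eval (cc f gs) xs y
    ev-r0 : ∀ {k} {g : Code k} {h xs y} → Eval g xs y → Eval (cr g h) (0 ∷ xs) y
    ev-rs : ∀ {k} {g : Code k} {h n xs r y} →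
            Eval (cr g h) (n ∷ xs) r → Eval h (n ∷ r ∷ xs) y →
            Eval (cr g h) (suc n ∷ xs) y
    ev-mu : ∀ {k} {f : Code (suc k)} {xs y} →
            Eval f (y ∷ xs) 0 →
            (∀ z → z < y → ∃ λ w → Eval f (z ∷ xs) (suc w)) →
            Eval (cmu f) xs y

  data EvalAll : ∀ {k m} → Vec (Code k) m → Vec ℕ k → Vec ℕ m → Set where
    ea-[] : ∀ {k} {xs : Vec ℕ k} → EvalAll [] xs []
    ea-∷  : ∀ {k m} {g : Code k} {gs : Vec (Code k) m} {xs y ys} →
            Eval g xs y → EvalAll gs xs ys → EvalAll (g ∷ gs) xs (y ∷ ys)

-- Binary strings, coded bijectively as naturals.

Str : Set
Str = List Bool

enc : Str → ℕ
enc []           = 0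
enc (false ∷ s)  = suc (2 * enc s)
enc (true ∷ s)   = suc (suc (2 * enc s))

-- A partial function {0,1}* → ℕ, given as its graph: f p y  ⇔  f(p) = y.
PFun : Set₁
PFun = Str → ℕ → Set

IsPR : PFun → Set
IsPR f = Σ (Code 1) λ c → ∀ p y → f p y ⇔ Eval c (enc p ∷ []) y

IsMinPR : PFun → Set
IsMinPR f = Σ (Code 2) λ c → ∀ p y →
  f p y ⇔ ((∃ λ t → Eval c (enc p ∷ t ∷ []) y) ×
           (∀ t z → Eval c (enc p ∷ t ∷ []) z → y ≤ z))

-- f ∈ Max_PR : f(p) = max { φ(p,t) : φ(p,t) defined } (undefined if empty / unbounded)
IsMaxPR : PFun → Set
IsMaxPR f = Σ (Code 2) λ c → ∀ p y →
  f p y ⇔ ((∃ λ t → Eval c (enc p ∷ t ∷ []) y) ×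
           (∀ t z → Eval c (enc p ∷ t ∷ []) z → z ≤ y))

-- K_V ≤ K_W + c  (unfolded: every W-program for x yields a V-program at most c longer)
KLeq+ : PFun → PFun → ℕ → Set
KLeq+ V W c = ∀ x p → W p x → ∃ λ q → V q x × length q ≤ length p + c

Optimal : (PFun → Set) → PFun → Set₁
Optimal Fam V = Fam V × (∀ W → Fam W → ∃ λ c → KLeq+ V W c)

-- K_f(x) ≥ m   (K_f(x) = min{|p| : f(p) = x}; vacuous if undefined)
KGe : PFun → ℕ → ℕ → Set
KGe f x m = ∀ p → f p x → m ≤ length p

InI : PFun → PFun → PFun → ℕ → Set
InI U Vmax Vmin x = KGe U x m × KGe Vmax x m × KGe Vmin x m
  where m = ⌊log₂ x ⌋ ∸ 1

Infinite : (ℕ → Set) → Set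
Infinite P = ∀ n → ∃ λ x → n ≤ x × P x

Rel : ℕ → Set₁
Rel n = ℕ → Vec Str n → Set

args : ∀ {n} → ℕ → Vec Str n → Vec ℕ (suc n)
args x vs = x ∷ Vec.map enc vs

IsRE : ∀ {n} → Rel n → Set
IsRE {n} R = Σ (Code (suc n)) λ c → ∀ x vs → R x vs ⇔ (∃ λ y → Eval c (args x vs) y)

IsCoRE : ∀ {n} → Rel n → Set
IsCoRE {n} R = Σ (Code (suc n)) λ c → ∀ x vs → R x vs ⇔ (¬ ∃ λ y → Eval c (args x vs) y)

IsΣ∨Π : ∀ {n} → Rel n → Set₁
IsΣ∨Π {n} A = Σ (Rel n) λ R → Σ (Rel n) λ S →
  IsRE R × IsCoRE S × (∀ x vs → A x vs ⇔ (R x vs ⊎ S x vs))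

DefForallLog : (ℕ → Set) → Set₁
DefForallLog P = Σ ℕ λ n → Σ (Rel n) λ A → Σ (Rel n) λ B →
  IsΣ∨Π A × IsΣ∨Π B ×
  (∀ x → P x ⇔ (∀ (vs : Vec Str n) → All (λ v → length v ≤ ⌊log₂ x ⌋) vs → A x vs × B x vs))

-- Δ⁰₂ = Σ⁰₂ ∩ Π⁰₂ (recursive matrix given by a total code; 0 means true)

Total : ∀ {k} → Code k → Set
Total c = ∀ xs → ∃ λ y → Eval c xs y

IsΣ2 : (ℕ → Set) → Set
IsΣ2 P = Σ (Code 3) λ c → Total c ×
  (∀ x → P x ⇔ (∃ λ a → ∀ b → Eval c (x ∷ a ∷ b ∷ []) 0))

IsΠ2 : (ℕ → Set) → Set
IsΠ2 P = Σ (Code 3) λ c → Total c ×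
  (∀ x → P x ⇔ (∀ a → ∃ λ b → Eval c (x ∷ a ∷ b ∷ []) 0))

IsΔ2 : (ℕ → Set) → Set
IsΔ2 P = IsΣ2 P × IsΠ2 P

-- K, K_max and K_min all measure descriptions in one way: a program e describes x when some
-- run φ(e, t) yields x and every value of φ(e, ·) is compatible with x (equal to it, at most x,
-- at least x). Failing to describe x is then the union of a Σ⁰₁ condition (an incompatible value
-- appears) and a Π⁰₁ one (x never appears), and a fuel-bounded interpreter of μ-recursive codes
-- makes both matrices recursive. Membership in I quantifies this over the programs shorter than
-- ⌊log x⌋ - 1: read as a bounded quantifier it gives a Δ⁰₂ form, read as a quantifier over
-- strings of length ≤ log x it gives the ∀^{≤log}(A ∧ B) form, a second string letting A cover two
-- of the three complexities. I is infinite by counting: the 3·2ⁿ numbers in [2ⁿ, 2ⁿ⁺²) have fewer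
-- than 3·2ⁿ short descriptions, and each describes at most one number.

module Submission where

open import Defs
open import Level using (0ℓ)
open import Axiom.ExcludedMiddle using (ExcludedMiddle)
open import Data.Product using (_×_)

open import Data.Nat
  using (ℕ; zero; suc; _+_; _*_; _∸_; _^_; _≤_; _<_; _⊔_; pred; ⌊_/2⌋; ⌈_/2⌉; z≤n; s≤s; z<s; _≤?_; _<?_)
open import Data.Nat.Properties
open import Data.Nat.Induction using (<-rec)
open import Data.Nat.Logarithm using (⌊log₂_⌋; ⌊log₂⌋-mono-≤; ⌊log₂[2^n]⌋≡n; ⌊log₂⌊n/2⌋⌋≡⌊log₂n⌋∸1)
open import Data.Bool using (true; false)
open import Data.List using ([]; _∷_; length)
open import Data.Fin using (Fin; zero; suc; _↑ʳ_; toℕ; fromℕ<; combine)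
open import Data.Fin.Properties using (toℕ<n; toℕ-injective; toℕ-fromℕ<; combine-injective; injective⇒≤)
open import Data.Nat.Tactic.RingSolver using (solve-∀)
open import Data.Vec using (Vec; []; _∷_; lookup; tabulate; head; tail; drop)
import Data.Vec as Vec
open import Data.Vec.Relation.Unary.All using (All; []; _∷_)
open import Data.Vec.Properties using (tabulate∘lookup; map-∘; map-id)
open import Data.Product using (Σ; ∃; _,_; proj₁; proj₂; map₂)
open import Data.Sum using (_⊎_; inj₁; inj₂; [_,_]′)
open import Data.Empty using (⊥-elim)
open import Data.Unit using (⊤; tt)
open import Relation.Nullary using (¬_; Dec; yes; no)
open import Relation.Nullary.Decidable using (map′)
open import Relation.Binary.PropositionalEquality using (_≡_; refl; sym; trans; cong; cong₂; subst)
open import Function using (_∘_)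
open import Function.Bundles using (_⇔_; mk⇔; Equivalence)
open import Function.Construct.Identity using (⇔-id)
open import Data.Sum.Function.Propositional using (_⊎-⇔_)
open import Data.Product.Function.NonDependent.Propositional using (_×-⇔_)
open import Function.Properties.Equivalence using () renaming (trans to ⇔-trans; sym to ⇔-sym)

open Equivalence using (to; from)

Computable : (k : ℕ) → (Vec ℕ k → ℕ) → Set
Computable k f = Σ (Code k) λ c → ∀ xs → Eval c xs (f xs)

Computables : (k m : ℕ) → (Vec ℕ k → Vec ℕ m) → Set
Computables k m f = Σ (Vec (Code k) m) λ ds → ∀ xs → EvalAll ds xs (f xs)

computable-ext : ∀ {k f g} → (∀ xs → f xs ≡ g xs) → Computable k f → Computable k g
computable-ext f≗g (c , ev) = c , λ xs → subst (Eval c xs) (f≗g xs) (ev xs)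

computables-ext : ∀ {k m f g} → (∀ xs → f xs ≡ g xs) → Computables k m f → Computables k m g
computables-ext f≗g (ds , ev) = ds , λ xs → subst (EvalAll ds xs) (f≗g xs) (ev xs)

[]ᶜ : ∀ {k} → Computables k 0 (λ _ → [])
[]ᶜ = [] , λ _ → ea-[]

infixr 5 _∷ᶜ_
_∷ᶜ_ : ∀ {k m f g} → Computable k f → Computables k m g → Computables k (suc m) (λ xs → f xs ∷ g xs)
(c , ev) ∷ᶜ (ds , evs) = c ∷ ds , λ xs → ea-∷ (ev xs) (evs xs)

infixr 4 _∘ᶜ_
_∘ᶜ_ : ∀ {k m f g} → Computable m f → Computables k m g → Computable k (f ∘ g)
(c , ev) ∘ᶜ (ds , evs) = cc c ds , λ xs → ev-c (evs xs) (ev _)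

infixr 4 _∘ᶜˢ_
_∘ᶜˢ_ : ∀ {k m n f g} → Computables m n f → Computables k m g → Computables k n (f ∘ g)
_∘ᶜˢ_ {g = g} (ds , evs) (es , evs′) = Vec.map (λ d → cc d es) ds , λ xs → compose (evs (g xs)) (evs′ xs)
  where
  compose : ∀ {n} {ds : Vec (Code _) n} {ys zs xs} → EvalAll ds ys zs → EvalAll es xs ys →
            EvalAll (Vec.map (λ d → cc d es) ds) xs zs
  compose ea-[]         _    = ea-[]
  compose (ea-∷ ev evs) evs′ = ea-∷ (ev-c evs′ ev) (compose evs evs′)

projᶜ : ∀ {k} (i : Fin k) → Computable k (λ xs → lookup xs i)
projᶜ i = cp i , λ _ → ev-p

zeroᶜ : ∀ {k} → Computable k (λ _ → 0)
zeroᶜ = cz , λ _ → ev-z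

suc-computable : Computable 1 (suc ∘ head)
suc-computable = cs , λ { (x ∷ []) → ev-s }

sucᶜ : ∀ {k f} → Computable k f → Computable k (suc ∘ f)
sucᶜ F = suc-computable ∘ᶜ F ∷ᶜ []ᶜ

constᶜ : ∀ {k} n → Computable k (λ _ → n)
constᶜ zero    = zeroᶜ
constᶜ (suc n) = sucᶜ (constᶜ n)

projsᶜ : ∀ {k m} (ι : Fin m → Fin k) → Computables k m (λ xs → tabulate (lookup xs ∘ ι))
projsᶜ {m = zero}  ι = []ᶜ
projsᶜ {m = suc m} ι = projᶜ (ι zero) ∷ᶜ projsᶜ (ι ∘ suc)

tabulate-lookup-↑ʳ : ∀ j {k} (xs : Vec ℕ (j + k)) → tabulate (lookup xs ∘ (j ↑ʳ_)) ≡ drop j xs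
tabulate-lookup-↑ʳ zero    xs       = tabulate∘lookup xs
tabulate-lookup-↑ʳ (suc j) (x ∷ xs) = tabulate-lookup-↑ʳ j xs

dropᶜ : ∀ j {k} → Computables (j + k) k (drop j)
dropᶜ j = computables-ext (tabulate-lookup-↑ʳ j) (projsᶜ (j ↑ʳ_))

natrec : ℕ → (ℕ → ℕ → ℕ) → ℕ → ℕ
natrec z s zero    = z
natrec z s (suc n) = s n (natrec z s n)

recᶜ : ∀ {k G H} → Computable k G → Computable (2 + k) H →
       Computable (suc k) (λ v → natrec (G (tail v)) (λ i r → H (i ∷ r ∷ tail v)) (head v))
recᶜ {G = G} {H} (g , evg) (h , evh) = cr g h , λ { (n ∷ xs) → go n xs }
  where
  go : ∀ n xs → Eval (cr g h) (n ∷ xs) (natrec (G xs) (λ i r → H (i ∷ r ∷ xs)) n)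
  go zero    xs = ev-r0 (evg xs)
  go (suc n) xs = ev-rs (go n xs) (evh _)

Computable₂ : (ℕ → ℕ → ℕ) → Set
Computable₂ _∙_ = Computable 2 (λ v → head v ∙ head (tail v))

lift₂ : ∀ {_∙_ k f g} → Computable₂ _∙_ → Computable k f → Computable k g → Computable k (λ xs → f xs ∙ g xs)
lift₂ op F G = op ∘ᶜ F ∷ᶜ G ∷ᶜ []ᶜ

+-computable : Computable₂ _+_
+-computable = c , λ { (m ∷ n ∷ []) → ev m n }
  where
  c : Code 2
  c = cr (cp zero) (cc cs (cp (suc zero) ∷ []))
  ev : ∀ m n → Eval c (m ∷ n ∷ []) (m + n)
  ev zero    n = ev-r0 ev-p
  ev (suc m) n = ev-rs (ev m n) (ev-c (ea-∷ ev-p ea-[]) ev-s)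

infixl 6 _+ᶜ_ _∸ᶜ_
infixl 7 _*ᶜ_

_+ᶜ_ : ∀ {k f g} → Computable k f → Computable k g → Computable k (λ xs → f xs + g xs)
_+ᶜ_ = lift₂ {_+_} +-computable

*-computable : Computable₂ _*_
*-computable = c , λ { (m ∷ n ∷ []) → ev m n }
  where
  c : Code 2
  c = cr cz (cc (proj₁ +-computable) (cp (suc (suc zero)) ∷ cp (suc zero) ∷ []))
  ev : ∀ m n → Eval c (m ∷ n ∷ []) (m * n)
  ev zero    n = ev-r0 ev-z
  ev (suc m) n = ev-rs (ev m n) (ev-c (ea-∷ ev-p (ea-∷ ev-p ea-[])) (proj₂ +-computable (n ∷ m * n ∷ [])))

_*ᶜ_ : ∀ {k f g} → Computable k f → Computable k g → Computable k (λ xs → f xs * g xs)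
_*ᶜ_ = lift₂ {_*_} *-computable

pred-computable : Computable 1 (pred ∘ head)
pred-computable = cr cz (cp zero) , λ { (n ∷ []) → ev n }
  where
  ev : ∀ n → Eval (cr cz (cp zero)) (n ∷ []) (pred n)
  ev zero    = ev-r0 ev-z
  ev (suc n) = ev-rs (ev n) ev-p

-- Recursion on the subtrahend, so the arguments are swapped.
∸-computable : Computable₂ (λ n m → m ∸ n)
∸-computable = c , λ { (n ∷ m ∷ []) → ev n m }
  where
  c : Code 2
  c = cr (cp zero) (cc (proj₁ pred-computable) (cp (suc zero) ∷ []))
  ev : ∀ n m → Eval c (n ∷ m ∷ []) (m ∸ n)
  ev zero    m = ev-r0 ev-p
  ev (suc n) m = ev-rs (ev n m)
    (subst (Eval _ _) (pred[m∸n]≡m∸[1+n] m n) (ev-c (ea-∷ ev-p ea-[]) (proj₂ pred-computable (m ∸ n ∷ []))))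

_∸ᶜ_ : ∀ {k f g} → Computable k f → Computable k g → Computable k (λ xs → f xs ∸ g xs)
F ∸ᶜ G = lift₂ {λ n m → m ∸ n} ∸-computable G F

predᶜ : ∀ {k f} → Computable k f → Computable k (pred ∘ f)
predᶜ F = pred-computable ∘ᶜ F ∷ᶜ []ᶜ

-- A fuel-bounded interpreter

sg : ℕ → ℕ
sg zero    = 0
sg (suc _) = 1

allHalted : ∀ {m} → Vec ℕ m → ℕ
allHalted []       = 1
allHalted (r ∷ rs) = sg r * allHalted rs

latch : ℕ → ℕ → ℕ
latch zero    t = t
latch (suc s) t = suc s

-- The μ-search state is 0 while searching, 1 once stalled and i + 2 once i is found; μ-step r i
-- is the next state when the body's run at candidate i is r.
μ-step : ℕ → ℕ → ℕ
μ-step zero          i = 1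
μ-step (suc zero)    i = suc (suc i)
μ-step (suc (suc _)) i = 0

μ-loop : (ℕ → ℕ) → ℕ → ℕ
μ-loop F = natrec 0 (λ i s → latch s (μ-step (F i) i))

-- run c n xs is suc y if c halts on xs with value y using fuel n (which also bounds every
-- μ-search), and 0 otherwise. Since run is itself computable (runᶜ), Eval becomes Σ⁰₁ with a
-- recursive matrix.
mutual
  run : ∀ {k} → Code k → ℕ → Vec ℕ k → ℕ
  run cz        n xs       = 1
  run cs        n (x ∷ []) = suc (suc x)
  run (cp i)    n xs       = suc (lookup xs i)
  run (cc f gs) n xs       = allHalted (runAll gs n xs) * run f n (Vec.map pred (runAll gs n xs))
  run (cr g h)  n (m ∷ xs) = natrec (run g n xs) (λ i r → sg r * run h n (i ∷ pred r ∷ xs)) m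
  run (cmu f)   n xs       = μ-loop (λ z → run f n (z ∷ xs)) n ∸ 1

  runAll : ∀ {k m} → Vec (Code k) m → ℕ → Vec ℕ k → Vec ℕ m
  runAll []       n xs = []
  runAll (g ∷ gs) n xs = run g n xs ∷ runAll gs n xs

<-suc-cases : ∀ {i n} → i < suc n → i < n ⊎ i ≡ n
<-suc-cases i<1+n = m≤n⇒m<n∨m≡n (≤-pred i<1+n)

allHalted-bit : ∀ {m} (rs : Vec ℕ m) → allHalted rs ≡ 0 ⊎ allHalted rs ≡ 1
allHalted-bit []           = inj₂ refl
allHalted-bit (zero  ∷ rs) = inj₁ refl
allHalted-bit (suc r ∷ rs) with allHalted-bit rs
... | inj₁ eq = inj₁ (trans (*-identityˡ (allHalted rs)) eq)
... | inj₂ eq = inj₂ (trans (*-identityˡ (allHalted rs)) eq)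

allHalted≡1⇒halted : ∀ {m} (rs : Vec ℕ m) → allHalted rs ≡ 1 → rs ≡ Vec.map suc (Vec.map pred rs)
allHalted≡1⇒halted []           eq = refl
allHalted≡1⇒halted (suc r ∷ rs) eq =
  cong (suc r ∷_) (allHalted≡1⇒halted rs (trans (sym (*-identityˡ (allHalted rs))) eq))

allHalted-map-suc : ∀ {m} (ys : Vec ℕ m) → allHalted (Vec.map suc ys) ≡ 1
allHalted-map-suc []       = refl
allHalted-map-suc (y ∷ ys) = trans (*-identityˡ _) (allHalted-map-suc ys)

map-pred-suc : ∀ {m} (ys : Vec ℕ m) → Vec.map pred (Vec.map suc ys) ≡ ys
map-pred-suc ys = trans (sym (map-∘ pred suc ys)) (map-id ys)

Passes : (ℕ → ℕ) → ℕ → Set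
Passes F y = ∀ z → z < y → ∃ λ w → F z ≡ suc (suc w)

Passes-weaken : ∀ {F y} → Passes F (suc y) → Passes F y
Passes-weaken passes z z<y = passes z (m≤n⇒m≤1+n z<y)

latch≡0 : ∀ s t → latch s t ≡ 0 → s ≡ 0 × t ≡ 0
latch≡0 zero t eq = refl , eq

μ-step≡0 : ∀ r i → μ-step r i ≡ 0 → ∃ λ w → r ≡ suc (suc w)
μ-step≡0 (suc (suc w)) i eq = w , refl

μ-step≡found : ∀ r i y → μ-step r i ≡ suc (suc y) → r ≡ 1 × y ≡ i
μ-step≡found (suc zero) i .i refl = refl , refl

μ-loop≡0⇒Passes : ∀ F i → μ-loop F i ≡ 0 → Passes F i
μ-loop≡0⇒Passes F (suc i) eq z z<1+i with latch≡0 (μ-loop F i) _ eq | <-suc-cases z<1+i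
... | searching , _    | inj₁ z<i  = μ-loop≡0⇒Passes F i searching z z<i
... | _         , step | inj₂ refl = μ-step≡0 (F z) z step

Passes⇒μ-loop≡0 : ∀ F i → Passes F i → μ-loop F i ≡ 0
Passes⇒μ-loop≡0 F zero    passes = refl
Passes⇒μ-loop≡0 F (suc i) passes rewrite Passes⇒μ-loop≡0 F i (Passes-weaken passes) with passes i ≤-refl
... | w , eq rewrite eq = refl

μ-loop-found⁻¹ : ∀ F i y → μ-loop F i ≡ suc (suc y) → y < i × F y ≡ 1 × Passes F y
μ-loop-found⁻¹ F (suc i) y eq with μ-loop F i in searched
... | zero with μ-step≡found (F i) i y eq
...   | F≡1 , refl = ≤-refl , F≡1 , μ-loop≡0⇒Passes F i searched
μ-loop-found⁻¹ F (suc i) y refl | suc (suc y′) with μ-loop-found⁻¹ F i y′ searched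
... | y<i , F≡1 , passes = m≤n⇒m≤1+n y<i , F≡1 , passes

μ-loop-found : ∀ F i y → y < i → F y ≡ 1 → Passes F y → μ-loop F i ≡ suc (suc y)
μ-loop-found F (suc i) y y<1+i F≡1 passes with <-suc-cases y<1+i
... | inj₁ y<i  rewrite μ-loop-found F i y y<i F≡1 passes = refl
... | inj₂ refl rewrite Passes⇒μ-loop≡0 F y passes | F≡1 = refl

module _ {k} {n : ℕ} {xs : Vec ℕ k} {y : ℕ} where

  run-cc : ∀ {m} (f : Code m) gs {ys} → runAll gs n xs ≡ Vec.map suc ys → run f n ys ≡ suc y →
           run (cc f gs) n xs ≡ suc y
  run-cc f gs {ys} gs-halt f-halts rewrite gs-halt | allHalted-map-suc ys | map-pred-suc ys =
    trans (*-identityˡ _) f-halts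

  run-cc⁻¹ : ∀ {m} (f : Code m) gs → run (cc f gs) n xs ≡ suc y →
             runAll gs n xs ≡ Vec.map suc (Vec.map pred (runAll gs n xs)) ×
             run f n (Vec.map pred (runAll gs n xs)) ≡ suc y
  run-cc⁻¹ f gs eq with allHalted-bit (runAll gs n xs)
  ... | inj₁ none rewrite none = ⊥-elim (0≢1+n eq)
  ... | inj₂ all  rewrite all  = allHalted≡1⇒halted (runAll gs n xs) all , trans (sym (*-identityˡ _)) eq

  run-rs : ∀ (g : Code k) h {m r} → run (cr g h) n (m ∷ xs) ≡ suc r → run h n (m ∷ r ∷ xs) ≡ suc y →
           run (cr g h) n (suc m ∷ xs) ≡ suc y
  run-rs g h rec-halts h-halts rewrite rec-halts = trans (*-identityˡ _) h-halts

  run-rs⁻¹ : ∀ (g : Code k) h m → run (cr g h) n (suc m ∷ xs) ≡ suc y →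
             ∃ λ r → run (cr g h) n (m ∷ xs) ≡ suc r × run h n (m ∷ r ∷ xs) ≡ suc y
  run-rs⁻¹ g h m eq with run (cr g h) n (m ∷ xs) | eq
  ... | suc r | h-halts = r , refl , trans (sym (*-identityˡ _)) h-halts

  run-μ : ∀ (f : Code (suc k)) → y < n → run f n (y ∷ xs) ≡ 1 → Passes (λ z → run f n (z ∷ xs)) y →
          run (cmu f) n xs ≡ suc y
  run-μ f y<n found passes = cong (_∸ 1) (μ-loop-found (λ z → run f n (z ∷ xs)) n y y<n found passes)

  run-μ⁻¹ : ∀ (f : Code (suc k)) → run (cmu f) n xs ≡ suc y →
            y < n × run f n (y ∷ xs) ≡ 1 × Passes (λ z → run f n (z ∷ xs)) y
  run-μ⁻¹ f eq = μ-loop-found⁻¹ (λ z → run f n (z ∷ xs)) n y (∸1≡1+ _ eq)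
    where
    ∸1≡1+ : ∀ a → a ∸ 1 ≡ suc y → a ≡ suc (suc y)
    ∸1≡1+ (suc a) eq = cong suc eq

mutual
  run-mono : ∀ {k} (c : Code k) {n n′} xs {y} → n ≤ n′ → run c n xs ≡ suc y → run c n′ xs ≡ suc y
  run-mono cz        xs       n≤n′ eq = eq
  run-mono cs        (x ∷ []) n≤n′ eq = eq
  run-mono (cp i)    xs       n≤n′ eq = eq
  run-mono (cc f gs) xs       n≤n′ eq with run-cc⁻¹ f gs eq
  ... | gs-halt , f-halts = run-cc f gs (runAll-mono gs xs n≤n′ gs-halt) (run-mono f _ n≤n′ f-halts)
  run-mono (cr g h) {n} {n′} (m ∷ xs) n≤n′ eq = go m eq
    where
    go : ∀ m {y} → run (cr g h) n (m ∷ xs) ≡ suc y → run (cr g h) n′ (m ∷ xs) ≡ suc y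
    go zero    eq = run-mono g xs n≤n′ eq
    go (suc m) eq with run-rs⁻¹ g h m eq
    ... | r , rec-halts , h-halts = run-rs g h (go m rec-halts) (run-mono h _ n≤n′ h-halts)
  run-mono (cmu f) xs n≤n′ eq with run-μ⁻¹ f eq
  ... | y<n , found , passes =
    run-μ f (≤-trans y<n n≤n′) (run-mono f _ n≤n′ found) (λ z z<y → map₂ (run-mono f _ n≤n′) (passes z z<y))

  runAll-mono : ∀ {k m} (gs : Vec (Code k) m) {n n′} xs {ys} → n ≤ n′ →
                runAll gs n xs ≡ Vec.map suc ys → runAll gs n′ xs ≡ Vec.map suc ys
  runAll-mono []       xs {[]}     n≤n′ eq = refl
  runAll-mono (g ∷ gs) xs {y ∷ ys} n≤n′ eq =
    cong₂ _∷_ (run-mono g xs n≤n′ (cong head eq)) (runAll-mono gs xs n≤n′ (cong tail eq))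

run-mono-⊔ˡ : ∀ {k} (c : Code k) {n} n′ {xs y} → run c n xs ≡ suc y → run c (n ⊔ n′) xs ≡ suc y
run-mono-⊔ˡ c {n} n′ = run-mono c _ (m≤m⊔n n n′)

run-mono-⊔ʳ : ∀ {k} (c : Code k) n {n′ xs y} → run c n′ xs ≡ suc y → run c (n ⊔ n′) xs ≡ suc y
run-mono-⊔ʳ c n {n′} = run-mono c _ (m≤n⊔m n n′)

mutual
  run-sound : ∀ {k} (c : Code k) n xs y → run c n xs ≡ suc y → Eval c xs y
  run-sound cz        n xs       .0             refl = ev-z
  run-sound cs        n (x ∷ []) .(suc x)       refl = ev-s
  run-sound (cp i)    n xs       .(lookup xs i) refl = ev-p
  run-sound (cc f gs) n xs y eq with run-cc⁻¹ f gs eq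
  ... | gs-halt , f-halts = ev-c (runAll-sound gs n xs _ gs-halt) (run-sound f n _ y f-halts)
  run-sound (cr g h) n (m ∷ xs) y eq = go m y eq
    where
    go : ∀ m y → run (cr g h) n (m ∷ xs) ≡ suc y → Eval (cr g h) (m ∷ xs) y
    go zero    y eq = ev-r0 (run-sound g n xs y eq)
    go (suc m) y eq with run-rs⁻¹ g h m eq
    ... | r , rec-halts , h-halts = ev-rs (go m r rec-halts) (run-sound h n _ y h-halts)
  run-sound (cmu f) n xs y eq with run-μ⁻¹ f eq
  ... | _ , found , passes =
    ev-mu (run-sound f n _ 0 found) (λ z z<y → map₂ (run-sound f n _ _) (passes z z<y))

  runAll-sound : ∀ {k m} (gs : Vec (Code k) m) n xs (ys : Vec ℕ m) →
                 runAll gs n xs ≡ Vec.map suc ys → EvalAll gs xs ys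
  runAll-sound []       n xs []       eq = ea-[]
  runAll-sound (g ∷ gs) n xs (y ∷ ys) eq =
    ea-∷ (run-sound g n xs y (cong head eq)) (runAll-sound gs n xs ys (cong tail eq))

Passes-fuel : ∀ {k} (f : Code (suc k)) xs y →
              (∀ z → z < y → ∃ λ w → ∃ λ n → run f n (z ∷ xs) ≡ suc (suc w)) →
              ∀ N → ∃ λ n → N ≤ n × Passes (λ z → run f n (z ∷ xs)) y
Passes-fuel f xs zero    halts N = N , ≤-refl , λ z ()
Passes-fuel f xs (suc y) halts N with Passes-fuel f xs y (λ z z<y → halts z (m≤n⇒m≤1+n z<y)) N | halts y ≤-refl
... | n₁ , N≤n₁ , passes | w , n₂ , eq = n₁ ⊔ n₂ , ≤-trans N≤n₁ (m≤m⊔n n₁ n₂) , passes′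
  where
  passes′ : Passes (λ z → run f (n₁ ⊔ n₂) (z ∷ xs)) (suc y)
  passes′ z z<1+y with <-suc-cases z<1+y
  ... | inj₁ z<y  = map₂ (run-mono-⊔ˡ f n₂) (passes z z<y)
  ... | inj₂ refl = w , run-mono-⊔ʳ f n₁ eq

mutual
  run-complete : ∀ {k} {c : Code k} {xs y} → Eval c xs y → ∃ λ n → run c n xs ≡ suc y
  run-complete ev-z = 0 , refl
  run-complete ev-s = 0 , refl
  run-complete ev-p = 0 , refl
  run-complete {c = cc f gs} (ev-c gs-ev f-ev) with runAll-complete gs-ev | run-complete f-ev
  ... | n₁ , eq₁ | n₂ , eq₂ = n₁ ⊔ n₂ , run-cc f gs (runAll-mono gs _ (m≤m⊔n n₁ n₂) eq₁) (run-mono-⊔ʳ f n₁ eq₂)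
  run-complete (ev-r0 g-ev) = run-complete g-ev
  run-complete {c = cr g h} {suc m ∷ xs} (ev-rs rec-ev h-ev) with run-complete rec-ev | run-complete h-ev
  ... | n₁ , eq₁ | n₂ , eq₂ = n₁ ⊔ n₂ , run-rs g h (run-mono-⊔ˡ (cr g h) n₂ {m ∷ xs} eq₁) (run-mono-⊔ʳ h n₁ eq₂)
  run-complete {c = cmu f} {xs} {y} (ev-mu found passes) with run-complete found
  ... | n₀ , eq₀ with Passes-fuel f xs y (λ z z<y → map₂ run-complete (passes z z<y)) (suc y ⊔ n₀)
  ... | N , y<N⊔n₀ , passes′ =
    N , run-μ f (≤-trans (m≤m⊔n (suc y) n₀) y<N⊔n₀) (run-mono f _ (≤-trans (m≤n⊔m (suc y) n₀) y<N⊔n₀) eq₀) passes′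

  runAll-complete : ∀ {k m} {gs : Vec (Code k) m} {xs ys} → EvalAll gs xs ys →
                    ∃ λ n → runAll gs n xs ≡ Vec.map suc ys
  runAll-complete ea-[] = 0 , refl
  runAll-complete {gs = g ∷ gs} (ea-∷ g-ev gs-ev) with run-complete g-ev | runAll-complete gs-ev
  ... | n₁ , eq₁ | n₂ , eq₂ = n₁ ⊔ n₂ , cong₂ _∷_ (run-mono-⊔ˡ g n₂ eq₁) (runAll-mono gs _ (m≤n⊔m n₁ n₂) eq₂)

Eval-functional : ∀ {k} {c : Code k} {xs y y′} → Eval c xs y → Eval c xs y′ → y ≡ y′
Eval-functional {c = c} ev ev′ with run-complete ev | run-complete ev′
... | n₁ , eq₁ | n₂ , eq₂ = suc-injective (trans (sym (run-mono-⊔ˡ c n₂ eq₁)) (run-mono-⊔ʳ c n₁ eq₂))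

sgᶜ : ∀ {k f} → Computable k f → Computable k (sg ∘ f)
sgᶜ {f = f} F = computable-ext (λ xs → 1∸[1∸n]≡sg (f xs)) (constᶜ 1 ∸ᶜ (constᶜ 1 ∸ᶜ F))
  where
  1∸[1∸n]≡sg : ∀ n → 1 ∸ (1 ∸ n) ≡ sg n
  1∸[1∸n]≡sg zero    = refl
  1∸[1∸n]≡sg (suc n) = cong (1 ∸_) (0∸n≡0 n)

latchᶜ : ∀ {k f g} → Computable k f → Computable k g → Computable k (λ xs → latch (f xs) (g xs))
latchᶜ {f = f} {g} F G = computable-ext (λ xs → latch-arith (f xs) (g xs)) (F +ᶜ (constᶜ 1 ∸ᶜ F) *ᶜ G)
  where
  latch-arith : ∀ s t → s + (1 ∸ s) * t ≡ latch s t
  latch-arith zero    t = *-identityˡ t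
  latch-arith (suc s) t rewrite 0∸n≡0 s = +-identityʳ (suc s)

μ-stepᶜ : ∀ {k f g} → Computable k f → Computable k g → Computable k (λ xs → μ-step (f xs) (g xs))
μ-stepᶜ {f = f} {g} F G = computable-ext (λ xs → μ-step-arith (f xs) (g xs))
  ((constᶜ 1 ∸ᶜ F) +ᶜ (constᶜ 1 ∸ᶜ (F ∸ᶜ constᶜ 1)) *ᶜ sgᶜ F *ᶜ sucᶜ (sucᶜ G))
  where
  μ-step-arith : ∀ r i → (1 ∸ r) + (1 ∸ (r ∸ 1)) * sg r * suc (suc i) ≡ μ-step r i
  μ-step-arith zero          i = refl
  μ-step-arith (suc zero)    i = +-identityʳ (suc (suc i))
  μ-step-arith (suc (suc r)) i rewrite 0∸n≡0 r = refl

mutual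
  runᶜ : ∀ {k} (c : Code k) → Computable (suc k) (λ v → run c (head v) (tail v))
  runᶜ cz        = computable-ext (λ { (n ∷ xs) → refl }) (constᶜ 1)
  runᶜ cs        = computable-ext (λ { (n ∷ x ∷ []) → refl }) (sucᶜ (sucᶜ (projᶜ (suc zero))))
  runᶜ (cp i)    = computable-ext (λ { (n ∷ xs) → refl }) (sucᶜ (projᶜ (suc i)))
  runᶜ (cc f gs) = computable-ext (λ { (n ∷ xs) → refl })
    (allHaltedᶜ gs *ᶜ (runᶜ f ∘ᶜ projᶜ zero ∷ᶜ predsᶜ gs))
  runᶜ (cr g h)  = computable-ext (λ { (n ∷ m ∷ xs) → refl })
    (recᶜ (runᶜ g) (sgᶜ (projᶜ (suc zero)) *ᶜ
                    (runᶜ h ∘ᶜ projᶜ (suc (suc zero)) ∷ᶜ projᶜ zero ∷ᶜ predᶜ (projᶜ (suc zero)) ∷ᶜ dropᶜ 3))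
      ∘ᶜ projᶜ (suc zero) ∷ᶜ projᶜ zero ∷ᶜ dropᶜ 2)
  runᶜ (cmu f)   = computable-ext (λ { (n ∷ xs) → refl })
    ((recᶜ zeroᶜ (latchᶜ (projᶜ (suc zero))
                         (μ-stepᶜ (runᶜ f ∘ᶜ projᶜ (suc (suc zero)) ∷ᶜ projᶜ zero ∷ᶜ dropᶜ 3) (projᶜ zero)))
       ∘ᶜ projᶜ zero ∷ᶜ dropᶜ 0)
     ∸ᶜ constᶜ 1)

  allHaltedᶜ : ∀ {k m} (gs : Vec (Code k) m) → Computable (suc k) (λ v → allHalted (runAll gs (head v) (tail v)))
  allHaltedᶜ []       = computable-ext (λ { (n ∷ xs) → refl }) (constᶜ 1)
  allHaltedᶜ (g ∷ gs) = computable-ext (λ { (n ∷ xs) → refl }) (sgᶜ (runᶜ g) *ᶜ allHaltedᶜ gs)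

  predsᶜ : ∀ {k m} (gs : Vec (Code k) m) → Computables (suc k) m (λ v → Vec.map pred (runAll gs (head v) (tail v)))
  predsᶜ []       = computables-ext (λ { (n ∷ xs) → refl }) []ᶜ
  predsᶜ (g ∷ gs) = computables-ext (λ { (n ∷ xs) → refl }) (predᶜ (runᶜ g) ∷ᶜ predsᶜ gs)

-- Recursive predicates

*-pos⇔ : ∀ m n → 0 < m * n ⇔ (0 < m × 0 < n)
*-pos⇔ m n = mk⇔ (pos m n) (λ (m>0 , n>0) → *-mono-≤ m>0 n>0)
  where
  pos : ∀ m n → 0 < m * n → 0 < m × 0 < n
  pos (suc m) zero    mn>0 = ⊥-elim (<-irrefl (sym (*-zeroʳ (suc m))) mn>0)
  pos (suc m) (suc n) _    = z<s , z<s

+-pos⇔ : ∀ m n → 0 < m + n ⇔ (0 < m ⊎ 0 < n)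
+-pos⇔ m n = mk⇔ (pos m) λ { (inj₁ m>0) → ≤-trans m>0 (m≤m+n m n) ; (inj₂ n>0) → ≤-trans n>0 (m≤n+m n m) }
  where
  pos : ∀ m → 0 < m + n → 0 < m ⊎ 0 < n
  pos zero    n>0 = inj₂ n>0
  pos (suc m) _   = inj₁ z<s

1∸-pos⇔ : ∀ n → 0 < 1 ∸ n ⇔ (¬ 0 < n)
1∸-pos⇔ n = mk⇔ (forward n) (backward n)
  where
  forward : ∀ n → 0 < 1 ∸ n → ¬ 0 < n
  forward (suc n) 1∸n>0 _ = <-irrefl (sym (0∸n≡0 n)) 1∸n>0
  backward : ∀ n → ¬ 0 < n → 0 < 1 ∸ n
  backward zero    _    = z<s
  backward (suc n) ¬n>0 = ⊥-elim (¬n>0 z<s)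

∸-pos⇔ : ∀ m n → 0 < m ∸ n ⇔ n < m
∸-pos⇔ m n = mk⇔ (λ m∸n>0 → m∸n≢0⇒n<m (n>0⇒n≢0 m∸n>0)) (λ n<m → n≢0⇒n>0 (m>n⇒m∸n≢0 n<m))

∏< : ℕ → (ℕ → ℕ) → ℕ
∏< n f = natrec 1 (λ i r → r * f i) n

∑< : ℕ → (ℕ → ℕ) → ℕ
∑< n f = natrec 0 (λ i r → r + f i) n

∏<-pos⇔ : ∀ n f → 0 < ∏< n f ⇔ (∀ i → i < n → 0 < f i)
∏<-pos⇔ n f = mk⇔ (forward n) (backward n)
  where
  forward : ∀ n → 0 < ∏< n f → ∀ i → i < n → 0 < f i
  forward (suc n) pos i i<1+n with to (*-pos⇔ (∏< n f) (f n)) pos | <-suc-cases i<1+n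
  ... | init , _    | inj₁ i<n  = forward n init i i<n
  ... | _    , last | inj₂ refl = last
  backward : ∀ n → (∀ i → i < n → 0 < f i) → 0 < ∏< n f
  backward zero    _   = z<s
  backward (suc n) all = from (*-pos⇔ (∏< n f) (f n)) (backward n (λ i i<n → all i (m≤n⇒m≤1+n i<n)) , all n ≤-refl)

∑<-pos⇔ : ∀ n f → 0 < ∑< n f ⇔ (∃ λ i → i < n × 0 < f i)
∑<-pos⇔ n f = mk⇔ (forward n) (backward n)
  where
  forward : ∀ n → 0 < ∑< n f → ∃ λ i → i < n × 0 < f i
  forward (suc n) pos with to (+-pos⇔ (∑< n f) (f n)) pos
  ... | inj₁ init = let i , i<n , fi>0 = forward n init in i , m≤n⇒m≤1+n i<n , fi>0
  ... | inj₂ last = n , ≤-refl , last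
  backward : ∀ n → (∃ λ i → i < n × 0 < f i) → 0 < ∑< n f
  backward (suc n) (i , i<1+n , fi>0) with <-suc-cases i<1+n
  ... | inj₁ i<n  = from (+-pos⇔ (∑< n f) (f n)) (inj₁ (backward n (i , i<n , fi>0)))
  ... | inj₂ refl = from (+-pos⇔ (∑< n f) (f n)) (inj₂ fi>0)

∏<ᶜ : ∀ {k g} → Computable (suc k) g → Computable (suc k) (λ v → ∏< (head v) (λ i → g (i ∷ tail v)))
∏<ᶜ G = computable-ext (λ { (n ∷ xs) → refl }) (recᶜ (constᶜ 1) (projᶜ (suc zero) *ᶜ (G ∘ᶜ projᶜ zero ∷ᶜ dropᶜ 2)))

∑<ᶜ : ∀ {k g} → Computable (suc k) g → Computable (suc k) (λ v → ∑< (head v) (λ i → g (i ∷ tail v)))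
∑<ᶜ G = computable-ext (λ { (n ∷ xs) → refl }) (recᶜ zeroᶜ (projᶜ (suc zero) +ᶜ (G ∘ᶜ projᶜ zero ∷ᶜ dropᶜ 2)))

record Recursive {k} (P : Vec ℕ k → Set) : Set where
  field
    χ            : Vec ℕ k → ℕ
    χ-computable : Computable k χ
    χ-pos⇔       : ∀ xs → 0 < χ xs ⇔ P xs

  decide : ∀ xs → Dec (P xs)
  decide xs = map′ (to (χ-pos⇔ xs)) (from (χ-pos⇔ xs)) (0 <? χ xs)

open Recursive

Recursive-⇔ : ∀ {k} {P Q : Vec ℕ k → Set} → (∀ xs → P xs ⇔ Q xs) → Recursive P → Recursive Q
Recursive-⇔ P⇔Q R = record
  { χ = χ R ; χ-computable = χ-computable R
  ; χ-pos⇔ = λ xs → mk⇔ (to (P⇔Q xs) ∘ to (χ-pos⇔ R xs)) (from (χ-pos⇔ R xs) ∘ from (P⇔Q xs)) }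

Recursive-∘ : ∀ {k m} {P : Vec ℕ m → Set} {f} → Recursive P → Computables k m f → Recursive (P ∘ f)
Recursive-∘ {f = f} R F = record { χ = χ R ∘ f ; χ-computable = χ-computable R ∘ᶜ F ; χ-pos⇔ = λ xs → χ-pos⇔ R _ }

posᴿ : ∀ {k f} → Computable k f → Recursive (λ xs → 0 < f xs)
posᴿ {f = f} F = record { χ = f ; χ-computable = F ; χ-pos⇔ = λ xs → ⇔-id _ }

¬ᴿ_ : ∀ {k} {P : Vec ℕ k → Set} → Recursive P → Recursive (¬_ ∘ P)
¬ᴿ R = record
  { χ = λ xs → 1 ∸ χ R xs ; χ-computable = constᶜ 1 ∸ᶜ χ-computable R
  ; χ-pos⇔ = λ xs → mk⇔ (λ p Pxs → to (1∸-pos⇔ _) p (from (χ-pos⇔ R xs) Pxs))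
                         (λ ¬Pxs → from (1∸-pos⇔ _) (¬Pxs ∘ to (χ-pos⇔ R xs))) }

infixr 3 _×ᴿ_
infixr 2 _⊎ᴿ_

_×ᴿ_ : ∀ {k} {P Q : Vec ℕ k → Set} → Recursive P → Recursive Q → Recursive (λ xs → P xs × Q xs)
R ×ᴿ S = record
  { χ = λ xs → χ R xs * χ S xs ; χ-computable = χ-computable R *ᶜ χ-computable S
  ; χ-pos⇔ = λ xs → mk⇔ (λ p → let r , s = to (*-pos⇔ _ _) p in to (χ-pos⇔ R xs) r , to (χ-pos⇔ S xs) s)
                         (λ (p , q) → from (*-pos⇔ _ _) (from (χ-pos⇔ R xs) p , from (χ-pos⇔ S xs) q)) }

_⊎ᴿ_ : ∀ {k} {P Q : Vec ℕ k → Set} → Recursive P → Recursive Q → Recursive (λ xs → P xs ⊎ Q xs)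
R ⊎ᴿ S = record
  { χ = λ xs → χ R xs + χ S xs ; χ-computable = χ-computable R +ᶜ χ-computable S
  ; χ-pos⇔ = λ xs → mk⇔ (Data.Sum.map (to (χ-pos⇔ R xs)) (to (χ-pos⇔ S xs)) ∘ to (+-pos⇔ _ _))
                         (from (+-pos⇔ _ _) ∘ Data.Sum.map (from (χ-pos⇔ R xs)) (from (χ-pos⇔ S xs))) }

≤ᴿ : ∀ {k f g} → Computable k f → Computable k g → Recursive (λ xs → f xs ≤ g xs)
≤ᴿ F G = Recursive-⇔
  (λ xs → mk⇔ (λ ¬pos → ≮⇒≥ (¬pos ∘ from (∸-pos⇔ _ _))) (λ f≤g pos → <⇒≱ (to (∸-pos⇔ _ _) pos) f≤g))
  (¬ᴿ posᴿ (F ∸ᶜ G))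

≡ᴿ : ∀ {k f g} → Computable k f → Computable k g → Recursive (λ xs → f xs ≡ g xs)
≡ᴿ F G = Recursive-⇔
  (λ xs → mk⇔ (λ (f≤g , g≤f) → ≤-antisym f≤g g≤f) (λ f≡g → ≤-reflexive f≡g , ≤-reflexive (sym f≡g)))
  (≤ᴿ F G ×ᴿ ≤ᴿ G F)

∀<ᴿ : ∀ {k N} {P : Vec ℕ (suc k) → Set} → Computable k N → Recursive P →
      Recursive (λ xs → ∀ i → i < N xs → P (i ∷ xs))
∀<ᴿ {N = N} N-computable R = record
  { χ = λ xs → ∏< (N xs) (λ i → χ R (i ∷ xs)) ; χ-computable = ∏<ᶜ (χ-computable R) ∘ᶜ N-computable ∷ᶜ dropᶜ 0
  ; χ-pos⇔ = λ xs → mk⇔ (λ pos i i<N → to (χ-pos⇔ R _) (to (∏<-pos⇔ _ _) pos i i<N))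
                         (λ all → from (∏<-pos⇔ _ _) λ i i<N → from (χ-pos⇔ R _) (all i i<N)) }

∃<ᴿ : ∀ {k N} {P : Vec ℕ (suc k) → Set} → Computable k N → Recursive P →
      Recursive (λ xs → ∃ λ i → i < N xs × P (i ∷ xs))
∃<ᴿ {N = N} N-computable R = record
  { χ = λ xs → ∑< (N xs) (λ i → χ R (i ∷ xs)) ; χ-computable = ∑<ᶜ (χ-computable R) ∘ᶜ N-computable ∷ᶜ dropᶜ 0
  ; χ-pos⇔ = λ xs → mk⇔ (λ pos → let i , i<N , χ>0 = to (∑<-pos⇔ _ _) pos in i , i<N , to (χ-pos⇔ R _) χ>0)
                         (λ (i , i<N , Pi) → from (∑<-pos⇔ _ _) (i , i<N , from (χ-pos⇔ R _) Pi)) }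

infixr 1 _→ᴿ_
_→ᴿ_ : ∀ {k} {P Q : Vec ℕ k → Set} → Recursive P → Recursive Q → Recursive (λ xs → P xs → Q xs)
_→ᴿ_ {P = P} {Q} R S =
  Recursive-⇔ (λ xs → mk⇔ (λ { (inj₁ ¬p) p → ⊥-elim (¬p p) ; (inj₂ q) _ → q }) (implication xs)) (¬ᴿ R ⊎ᴿ S)
  where
  implication : ∀ xs → (P xs → Q xs) → ¬ P xs ⊎ Q xs
  implication xs p⇒q with decide R xs
  ... | yes p = inj₂ (p⇒q p)
  ... | no ¬p = inj₁ ¬p

⊤ᴿ : ∀ {k} → Recursive {k} (λ _ → ⊤)
⊤ᴿ = Recursive-⇔ (λ _ → mk⇔ (λ _ → tt) (λ _ → z<s)) (posᴿ (constᶜ 1))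

Cases : Set → Set → Set → Set
Cases D A B = (D → A) × (¬ D → B)

Cases-yes : ∀ {D A B} → D → Cases D A B ⇔ A
Cases-yes d = mk⇔ (λ (if , _) → if d) (λ a → (λ _ → a) , (λ ¬d → ⊥-elim (¬d d)))

Cases-no : ∀ {D A B} → ¬ D → Cases D A B ⇔ B
Cases-no ¬d = mk⇔ (λ (_ , else) → else ¬d) (λ b → (λ d → ⊥-elim (¬d d)) , (λ _ → b))

casesᴿ : ∀ {k} {D A B : Vec ℕ k → Set} → Recursive D → Recursive A → Recursive B →
         Recursive (λ xs → Cases (D xs) (A xs) (B xs))
casesᴿ R S T = (R →ᴿ S) ×ᴿ (¬ᴿ R →ᴿ T)

zero-test : ∀ {k} {P : Vec ℕ k → Set} → Recursive P →
            Σ (Code k) λ c → Total c × ∀ xs → Eval c xs 0 ⇔ P xs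
zero-test R with constᶜ 1 ∸ᶜ χ-computable R
... | c , ev = c , (λ xs → _ , ev xs) , λ xs → mk⇔
  (λ ev0 → to (χ-pos⇔ R xs) (n≢0⇒n>0 λ χ≡0 →
     0≢1+n (Eval-functional ev0 (subst (Eval c xs) (cong (1 ∸_) χ≡0) (ev xs)))))
  (λ Pxs → subst (Eval c xs) (1∸pos≡0 (from (χ-pos⇔ R xs) Pxs)) (ev xs))
  where
  1∸pos≡0 : ∀ {n} → 0 < n → 1 ∸ n ≡ 0
  1∸pos≡0 {suc n} _ = 0∸n≡0 n

least-below : ∀ {P : ℕ → Set} → (∀ n → Dec (P n)) →
              ∀ N → (∃ λ y → y < N × P y × ∀ z → z < y → ¬ P z) ⊎ (∀ z → z < N → ¬ P z)
least-below P? zero = inj₂ λ _ ()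
least-below P? (suc N) with least-below P? N | P? N
... | inj₁ (y , y<N , Py , least) | _      = inj₁ (y , m≤n⇒m≤1+n y<N , Py , least)
... | inj₂ none                   | yes PN = inj₁ (N , ≤-refl , PN , none)
... | inj₂ none                   | no ¬PN = inj₂ λ z z<1+N → [ none z , (λ { refl → ¬PN }) ]′ (<-suc-cases z<1+N)

least-witness : ∀ {P : ℕ → Set} → (∀ n → Dec (P n)) → ∀ {n} → P n → ∃ λ y → P y × ∀ z → z < y → ¬ P z
least-witness P? {n} Pn with least-below P? (suc n)
... | inj₁ (y , _ , Py , least) = y , Py , least
... | inj₂ none                 = ⊥-elim (none n ≤-refl Pn)

∃-semidecidable : ∀ {k} {P : Vec ℕ (suc k) → Set} → Recursive P →
                  Σ (Code k) λ c → ∀ xs → (∃ λ y → Eval c xs y) ⇔ (∃ λ w → P (w ∷ xs))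
∃-semidecidable {P = P} R with zero-test R
... | c , total , test = cmu c , λ xs → mk⇔ (λ { (y , ev-mu ev0 _) → y , to (test _) ev0 }) (search xs)
  where
  nonzero : ∀ {z xs} → ¬ P (z ∷ xs) → ∃ λ w → Eval c (z ∷ xs) (suc w)
  nonzero {z} {xs} ¬Pz with total (z ∷ xs)
  ... | zero  , ev0 = ⊥-elim (¬Pz (to (test _) ev0))
  ... | suc w , ev  = w , ev
  search : ∀ xs → (∃ λ w → P (w ∷ xs)) → ∃ λ y → Eval (cmu c) xs y
  search xs (w , Pw) with least-witness (λ n → decide R (n ∷ xs)) Pw
  ... | y , Py , least = y , ev-mu (from (test _) Py) (λ z z<y → nonzero (least z z<y))

-- Σ⁰₁ ∨ Π⁰₁ conditions and Δ⁰₂ forms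

record Σ₁∨Π₁ {k} (Q : Vec ℕ k → Set) : Set₁ where
  field
    Σ-matrix Π-matrix : Vec ℕ (suc k) → Set
    Σ-recursive       : Recursive Σ-matrix
    Π-recursive       : Recursive Π-matrix
    Σ⊎Π⇔              : ∀ xs → Q xs ⇔ ((∃ λ w → Σ-matrix (w ∷ xs)) ⊎ (∀ b → Π-matrix (b ∷ xs)))

open Σ₁∨Π₁

Σ₁∨Π₁-⇔ : ∀ {k} {P Q : Vec ℕ k → Set} → (∀ xs → P xs ⇔ Q xs) → Σ₁∨Π₁ P → Σ₁∨Π₁ Q
Σ₁∨Π₁-⇔ P⇔Q S = record
  { Σ-recursive = Σ-recursive S ; Π-recursive = Π-recursive S
  ; Σ⊎Π⇔ = λ xs → mk⇔ (to (Σ⊎Π⇔ S xs) ∘ from (P⇔Q xs)) (to (P⇔Q xs) ∘ from (Σ⊎Π⇔ S xs)) }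

Σ₁∨Π₁-∘ : ∀ {k m} {Q : Vec ℕ m → Set} {f} → Σ₁∨Π₁ Q → Computables k m f → Σ₁∨Π₁ (Q ∘ f)
Σ₁∨Π₁-∘ {k} {m} {f = f} S F = record
  { Σ-recursive = Recursive-∘ (Σ-recursive S) shifted ; Π-recursive = Recursive-∘ (Π-recursive S) shifted
  ; Σ⊎Π⇔ = λ xs → Σ⊎Π⇔ S _ }
  where
  shifted : Computables (suc k) (suc m) (λ v → lookup v zero ∷ f (drop 1 v))
  shifted = projᶜ zero ∷ᶜ (F ∘ᶜˢ dropᶜ 1)

∃⊎∀-⇔ : ∀ {S S′ P P′ : ℕ → Set} → (∀ w → S w ⇔ S′ w) → (∀ b → P b ⇔ P′ b) →
        ((∃ λ w → S w) ⊎ (∀ b → P b)) ⇔ ((∃ λ w → S′ w) ⊎ (∀ b → P′ b))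
∃⊎∀-⇔ S⇔ P⇔ = mk⇔ (Data.Sum.map (λ (w , s) → w , to (S⇔ w) s) (λ π b → to (P⇔ b) (π b)))
                   (Data.Sum.map (λ (w , s) → w , from (S⇔ w) s) (λ π b → from (P⇔ b) (π b)))

Cases-∃⊎∀ : ∀ {D Q₁ Q₂ : Set} {S₁ S₂ P₁ P₂ : ℕ → Set} → Dec D →
            Q₁ ⇔ ((∃ λ w → S₁ w) ⊎ (∀ b → P₁ b)) → Q₂ ⇔ ((∃ λ w → S₂ w) ⊎ (∀ b → P₂ b)) →
            Cases D Q₁ Q₂ ⇔ ((∃ λ w → Cases D (S₁ w) (S₂ w)) ⊎ (∀ b → Cases D (P₁ b) (P₂ b)))
Cases-∃⊎∀ (yes d) Q₁⇔ _ =
  ⇔-trans (Cases-yes d) (⇔-trans Q₁⇔ (⇔-sym (∃⊎∀-⇔ (λ _ → Cases-yes d) (λ _ → Cases-yes d))))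
Cases-∃⊎∀ (no ¬d) _ Q₂⇔ =
  ⇔-trans (Cases-no ¬d) (⇔-trans Q₂⇔ (⇔-sym (∃⊎∀-⇔ (λ _ → Cases-no ¬d) (λ _ → Cases-no ¬d))))

Σ₁∨Π₁-cases : ∀ {k} {D Q₁ Q₂ : Vec ℕ k → Set} → Recursive D → Σ₁∨Π₁ Q₁ → Σ₁∨Π₁ Q₂ →
              Σ₁∨Π₁ (λ xs → Cases (D xs) (Q₁ xs) (Q₂ xs))
Σ₁∨Π₁-cases R S₁ S₂ = record
  { Σ-recursive = casesᴿ (Recursive-∘ R (dropᶜ 1)) (Σ-recursive S₁) (Σ-recursive S₂)
  ; Π-recursive = casesᴿ (Recursive-∘ R (dropᶜ 1)) (Π-recursive S₁) (Π-recursive S₂)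
  ; Σ⊎Π⇔ = λ xs → Cases-∃⊎∀ (decide R xs) (Σ⊎Π⇔ S₁ xs) (Σ⊎Π⇔ S₂ xs) }

Σ₁∨Π₁-→ : ∀ {k} {D Q : Vec ℕ k → Set} → Recursive D → Σ₁∨Π₁ Q → Σ₁∨Π₁ (λ xs → D xs → Q xs)
Σ₁∨Π₁-→ R S = Σ₁∨Π₁-⇔ (λ _ → mk⇔ proj₁ (λ q → q , λ _ → tt)) (Σ₁∨Π₁-cases R S trivial)
  where
  trivial : Σ₁∨Π₁ (λ _ → ⊤)
  trivial = record { Σ-recursive = ⊤ᴿ ; Π-recursive = ⊤ᴿ ; Σ⊎Π⇔ = λ _ → mk⇔ (λ _ → inj₁ (0 , tt)) (λ _ → tt) }

Σ₁∨Π₁⇒IsΣ∨Π : ∀ {n} {A : Rel n} {Q : Vec ℕ (suc n) → Set} → Σ₁∨Π₁ Q →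
               (∀ x vs → A x vs ⇔ Q (args x vs)) → IsΣ∨Π A
Σ₁∨Π₁⇒IsΣ∨Π S A⇔Q with ∃-semidecidable (Σ-recursive S) | ∃-semidecidable (¬ᴿ Π-recursive S)
... | c-Σ , Σ-halts | c-¬Π , ¬Π-halts =
  _ , _ , (c-Σ , λ x vs → ⇔-sym (Σ-halts (args x vs))) , (c-¬Π , λ x vs → ∀Π⇔¬∃¬Π (args x vs)) ,
  λ x vs → ⇔-trans (A⇔Q x vs) (Σ⊎Π⇔ S _)
  where
  ∀Π⇔¬∃¬Π : ∀ xs → (∀ b → Π-matrix S (b ∷ xs)) ⇔ (¬ ∃ λ y → Eval c-¬Π xs y)
  ∀Π⇔¬∃¬Π xs = mk⇔ (λ π halts → let b , ¬π = to (¬Π-halts xs) halts in ¬π (π b)) stable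
    where
    stable : (¬ ∃ λ y → Eval c-¬Π xs y) → ∀ b → Π-matrix S (b ∷ xs)
    stable never b with decide (Π-recursive S) (b ∷ xs)
    ... | yes π = π
    ... | no ¬π = ⊥-elim (never (from (¬Π-halts xs) (b , ¬π)))

record Δ₂Form {k} (P : Vec ℕ k → Set) : Set₁ where
  field
    M           : Vec ℕ (2 + k) → Set
    M-recursive : Recursive M
    M-mono      : ∀ {a a′} b xs → a ≤ a′ → M (a ∷ b ∷ xs) → M (a′ ∷ b ∷ xs)
    ∃∀⇔         : ∀ xs → P xs ⇔ (∃ λ a → ∀ b → M (a ∷ b ∷ xs))
    ∀∃⇔         : ∀ xs → P xs ⇔ (∀ b → ∃ λ a → M (a ∷ b ∷ xs))

open Δ₂Form

-- a bounds the Σ-witness and b instantiates the Π-matrix; only going back from the ∀∃ form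
-- needs excluded middle.
Σ₁∨Π₁⇒Δ₂Form : ExcludedMiddle 0ℓ → ∀ {k} {Q : Vec ℕ k → Set} → Σ₁∨Π₁ Q → Δ₂Form Q
Σ₁∨Π₁⇒Δ₂Form lem S = record
  { M = λ v → (∃ λ w → w < lookup v zero × Σ-matrix S (w ∷ drop 2 v)) ⊎
              Π-matrix S (lookup v (suc zero) ∷ drop 2 v)
  ; M-recursive = Σ-below ⊎ᴿ Recursive-∘ (Π-recursive S) (projᶜ (suc zero) ∷ᶜ dropᶜ 2)
  ; M-mono = λ { b xs a≤a′ (inj₁ (w , w<a , σ)) → inj₁ (w , <-≤-trans w<a a≤a′ , σ) ; b xs a≤a′ (inj₂ π) → inj₂ π }
  ; ∃∀⇔ = λ xs → mk⇔ (witness-bound ∘ to (Σ⊎Π⇔ S xs)) (from (Σ⊎Π⇔ S xs) ∘ bounded-search xs)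
  ; ∀∃⇔ = λ xs → mk⇔ (λ q b → let a , m = witness-bound (to (Σ⊎Π⇔ S xs) q) in a , m b)
                      (from (Σ⊎Π⇔ S xs) ∘ excluded-middle xs) }
  where
  Σ-below : Recursive (λ v → ∃ λ w → w < lookup v zero × Σ-matrix S (w ∷ drop 2 v))
  Σ-below = ∃<ᴿ (projᶜ zero) (Recursive-∘ (Σ-recursive S) (projᶜ zero ∷ᶜ dropᶜ 3))
  witness-bound : ∀ {xs} → (∃ λ w → Σ-matrix S (w ∷ xs)) ⊎ (∀ b → Π-matrix S (b ∷ xs)) →
                  ∃ λ a → ∀ b → (∃ λ w → w < a × Σ-matrix S (w ∷ xs)) ⊎ Π-matrix S (b ∷ xs)
  witness-bound (inj₁ (w , σ)) = suc w , λ _ → inj₁ (w , ≤-refl , σ)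
  witness-bound (inj₂ π)       = 0 , λ b → inj₂ (π b)
  bounded-search : ∀ xs → (∃ λ a → ∀ b → (∃ λ w → w < a × Σ-matrix S (w ∷ xs)) ⊎ Π-matrix S (b ∷ xs)) →
                   (∃ λ w → Σ-matrix S (w ∷ xs)) ⊎ (∀ b → Π-matrix S (b ∷ xs))
  bounded-search xs (a , m) with decide Σ-below (a ∷ 0 ∷ xs)
  ... | yes (w , _ , σ) = inj₁ (w , σ)
  ... | no none = inj₂ λ b → [ (λ found → ⊥-elim (none found)) , (λ π → π) ]′ (m b)
  excluded-middle : ∀ xs → (∀ b → ∃ λ a → (∃ λ w → w < a × Σ-matrix S (w ∷ xs)) ⊎ Π-matrix S (b ∷ xs)) →
                    (∃ λ w → Σ-matrix S (w ∷ xs)) ⊎ (∀ b → Π-matrix S (b ∷ xs))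
  excluded-middle xs m with lem {∃ λ w → Σ-matrix S (w ∷ xs)}
  ... | yes σ = inj₁ σ
  ... | no ¬σ = inj₂ λ b → [ (λ (w , _ , σ) → ⊥-elim (¬σ (w , σ))) , (λ π → π) ]′ (proj₂ (m b))

Δ₂Form-⇔ : ∀ {k} {P Q : Vec ℕ k → Set} → (∀ xs → P xs ⇔ Q xs) → Δ₂Form P → Δ₂Form Q
Δ₂Form-⇔ P⇔Q D = record
  { M-recursive = M-recursive D ; M-mono = M-mono D
  ; ∃∀⇔ = λ xs → ⇔-trans (⇔-sym (P⇔Q xs)) (∃∀⇔ D xs)
  ; ∀∃⇔ = λ xs → ⇔-trans (⇔-sym (P⇔Q xs)) (∀∃⇔ D xs) }

Δ₂Form-× : ∀ {k} {P Q : Vec ℕ k → Set} → Δ₂Form P → Δ₂Form Q → Δ₂Form (λ xs → P xs × Q xs)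
Δ₂Form-× D E = record
  { M-recursive = M-recursive D ×ᴿ M-recursive E
  ; M-mono = λ b xs a≤a′ (m , n) → M-mono D b xs a≤a′ m , M-mono E b xs a≤a′ n
  ; ∃∀⇔ = λ xs → mk⇔
      (λ (p , q) → let a , m = to (∃∀⇔ D xs) p ; a′ , n = to (∃∀⇔ E xs) q in
                   a ⊔ a′ , λ b → M-mono D b xs (m≤m⊔n a a′) (m b) , M-mono E b xs (m≤n⊔m a a′) (n b))
      (λ (a , mn) → from (∃∀⇔ D xs) (a , proj₁ ∘ mn) , from (∃∀⇔ E xs) (a , proj₂ ∘ mn))
  ; ∀∃⇔ = λ xs → mk⇔
      (λ (p , q) b → let a , m = to (∀∃⇔ D xs) p b ; a′ , n = to (∀∃⇔ E xs) q b in
                     a ⊔ a′ , M-mono D b xs (m≤m⊔n a a′) m , M-mono E b xs (m≤n⊔m a a′) n)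
      (λ mn → from (∀∃⇔ D xs) (λ b → proj₁ (mn b) , proj₁ (proj₂ (mn b))) ,
              from (∀∃⇔ E xs) (λ b → proj₁ (mn b) , proj₂ (proj₂ (mn b)))) }

bounded-choice : ∀ {R : ℕ → ℕ → Set} → (∀ {i a a′} → a ≤ a′ → R i a → R i a′) →
                 ∀ n → (∀ i → i < n → ∃ (R i)) → ∃ λ a → ∀ i → i < n → R i a
bounded-choice mono zero    choose = 0 , λ _ ()
bounded-choice mono (suc n) choose with bounded-choice mono n (λ i i<n → choose i (m≤n⇒m≤1+n i<n)) | choose n ≤-refl
... | a , all | a′ , last = a ⊔ a′ , λ i i<1+n →
  [ (λ i<n → mono (m≤m⊔n a a′) (all i i<n)) , (λ { refl → mono (m≤n⊔m a a′) last }) ]′ (<-suc-cases i<1+n)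

Δ₂Form-∀< : ∀ {k N} {P : Vec ℕ (suc k) → Set} → Computable k N → Δ₂Form P →
            Δ₂Form (λ xs → ∀ i → i < N xs → P (i ∷ xs))
Δ₂Form-∀< {N = N} N-computable D = record
  { M-recursive = ∀<ᴿ (N-computable ∘ᶜ dropᶜ 2)
                      (Recursive-∘ (M-recursive D)
                                   (projᶜ (suc zero) ∷ᶜ projᶜ (suc (suc zero)) ∷ᶜ projᶜ zero ∷ᶜ dropᶜ 3))
  ; M-mono = λ b xs a≤a′ m i i<N → M-mono D b (i ∷ xs) a≤a′ (m i i<N)
  ; ∃∀⇔ = λ xs → mk⇔
      (λ p → let a , m = bounded-choice (λ a≤a′ m b → M-mono D b _ a≤a′ (m b)) (N xs)
                                        (λ i i<N → to (∃∀⇔ D (i ∷ xs)) (p i i<N))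
             in a , λ b i i<N → m i i<N b)
      (λ (a , m) i i<N → from (∃∀⇔ D (i ∷ xs)) (a , λ b → m b i i<N))
  ; ∀∃⇔ = λ xs → mk⇔
      (λ p b → bounded-choice (M-mono D b _) (N xs) (λ i i<N → to (∀∃⇔ D (i ∷ xs)) (p i i<N) b))
      (λ m i i<N → from (∀∃⇔ D (i ∷ xs)) (λ b → let a , m′ = m b in a , m′ i i<N)) }

Δ₂Form⇒IsΔ2 : ∀ {P : Vec ℕ 1 → Set} → Δ₂Form P → IsΔ2 (λ x → P (x ∷ []))
Δ₂Form⇒IsΔ2 D
  with zero-test (Recursive-∘ (M-recursive D) (projᶜ (suc zero) ∷ᶜ projᶜ (suc (suc zero)) ∷ᶜ projᶜ zero ∷ᶜ []ᶜ))
     | zero-test (Recursive-∘ (M-recursive D) (projᶜ (suc (suc zero)) ∷ᶜ projᶜ (suc zero) ∷ᶜ projᶜ zero ∷ᶜ []ᶜ))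
... | c , c-total , c-test | c′ , c′-total , c′-test =
  (c , c-total , λ x → ⇔-trans (∃∀⇔ D (x ∷ [])) (mk⇔ (map₂ λ m b → from (c-test _) (m b))
                                                     (map₂ λ ev b → to (c-test _) (ev b)))) ,
  (c′ , c′-total , λ x → ⇔-trans (∀∃⇔ D (x ∷ [])) (mk⇔ (λ m b → map₂ (from (c′-test _)) (m b))
                                                        (λ ev b → map₂ (to (c′-test _)) (ev b))))

record Describer : Set₁ where
  field
    φ                    : Code 2
    Compatible           : ℕ → ℕ → Set
    Compatible-recursive : Recursive {2} (λ v → Compatible (lookup v zero) (lookup v (suc zero)))
    Compatible-antisym   : ∀ {x z} → Compatible x z → Compatible z x → x ≡ z

open Describer

Describes : Describer → ℕ → ℕ → Set
Describes d e x = (∃ λ t → Eval (φ d) (e ∷ t ∷ []) x) × (∀ t z → Eval (φ d) (e ∷ t ∷ []) z → Compatible d x z)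

Describes-functional : ∀ d {e x x′} → Describes d e x → Describes d e x′ → x ≡ x′
Describes-functional d ((t , ev) , compatible) ((t′ , ev′) , compatible′) =
  Compatible-antisym d (compatible t′ _ ev′) (compatible′ t _ ev)

record Represents (d : Describer) (f : PFun) : Set where
  constructor represents
  field describes⇔ : ∀ p x → Describes d (enc p) x ⇔ f p x

open Represents

describer-PR : Code 1 → Describer
describer-PR c = record
  { φ = cc c (cp zero ∷ []) ; Compatible = _≡_
  ; Compatible-recursive = ≡ᴿ (projᶜ zero) (projᶜ (suc zero)) ; Compatible-antisym = λ x≡z _ → x≡z }

describer-max : Code 2 → Describer
describer-max c = record
  { φ = c ; Compatible = λ x z → z ≤ x
  ; Compatible-recursive = ≤ᴿ (projᶜ (suc zero)) (projᶜ zero) ; Compatible-antisym = λ z≤x x≤z → ≤-antisym x≤z z≤x }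

describer-min : Code 2 → Describer
describer-min c = record
  { φ = c ; Compatible = _≤_
  ; Compatible-recursive = ≤ᴿ (projᶜ zero) (projᶜ (suc zero)) ; Compatible-antisym = ≤-antisym }

IsPR⇒Represents : ∀ {f} (hf : IsPR f) → Represents (describer-PR (proj₁ hf)) f
IsPR⇒Represents (c , c⇔) = represents λ p x → mk⇔
  (λ { ((_ , ev-c (ea-∷ ev-p ea-[]) ev) , _) → from (c⇔ p x) ev })
  (λ fpx → (0 , ev-c (ea-∷ ev-p ea-[]) (to (c⇔ p x) fpx)) ,
           λ { _ _ (ev-c (ea-∷ ev-p ea-[]) ev) → Eval-functional (to (c⇔ p x) fpx) ev })

IsMaxPR⇒Represents : ∀ {f} (hf : IsMaxPR f) → Represents (describer-max (proj₁ hf)) f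
IsMaxPR⇒Represents (c , c⇔) = represents λ p x → ⇔-sym (c⇔ p x)

IsMinPR⇒Represents : ∀ {f} (hf : IsMinPR f) → Represents (describer-min (proj₁ hf)) f
IsMinPR⇒Represents (c , c⇔) = represents λ p x → ⇔-sym (c⇔ p x)

HaltsIncompatibly : Describer → Vec ℕ 4 → Set
HaltsIncompatibly d (t ∷ w ∷ e ∷ x ∷ []) = ∃ λ z → run (φ d) w (e ∷ t ∷ []) ≡ suc z × ¬ Compatible d x z

Refutes : Describer → Vec ℕ 3 → Set
Refutes d (w ∷ e ∷ x ∷ []) = ∃ λ t → t < suc w × HaltsIncompatibly d (t ∷ w ∷ e ∷ x ∷ [])

Misses : Describer → Vec ℕ 3 → Set
Misses d (b ∷ e ∷ x ∷ []) = ∀ t → t < suc b → ¬ run (φ d) b (e ∷ t ∷ []) ≡ suc x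

pos-pred⇔ : ∀ {P : ℕ → Set} r → (0 < r × P (pred r)) ⇔ (∃ λ z → r ≡ suc z × P z)
pos-pred⇔ zero    = mk⇔ (λ ()) (λ { (_ , () , _) })
pos-pred⇔ (suc r) = mk⇔ (λ (_ , p) → r , refl , p) (λ { (_ , refl , p) → z<s , p })

runᶜ-at : ∀ d → Computable 4
  (λ v → run (φ d) (lookup v (suc zero)) (lookup v (suc (suc zero)) ∷ lookup v zero ∷ []))
runᶜ-at d = runᶜ (φ d) ∘ᶜ projᶜ (suc zero) ∷ᶜ projᶜ (suc (suc zero)) ∷ᶜ projᶜ zero ∷ᶜ []ᶜ

Refutes-recursive : ∀ d → Recursive (Refutes d)
Refutes-recursive d = Recursive-⇔ (λ { (w ∷ e ∷ x ∷ []) → ⇔-id _ })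
  (∃<ᴿ (sucᶜ (projᶜ zero))
       (Recursive-⇔ {Q = HaltsIncompatibly d}
                    (λ { (t ∷ w ∷ e ∷ x ∷ []) → pos-pred⇔ {¬_ ∘ Compatible d x} (run (φ d) w (e ∷ t ∷ [])) })
                    (posᴿ (runᶜ-at d) ×ᴿ ¬ᴿ Recursive-∘ (Compatible-recursive d)
                                                        (projᶜ (suc (suc (suc zero))) ∷ᶜ predᶜ (runᶜ-at d) ∷ᶜ []ᶜ))))

Misses-recursive : ∀ d → Recursive (Misses d)
Misses-recursive d = Recursive-⇔ (λ { (b ∷ e ∷ x ∷ []) → ⇔-id _ })
  (∀<ᴿ (sucᶜ (projᶜ zero)) (¬ᴿ ≡ᴿ (runᶜ-at d) (sucᶜ (projᶜ (suc (suc (suc zero)))))))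

Refuted : Describer → ℕ → ℕ → Set
Refuted d e x = ∃ λ t → ∃ λ z → Eval (φ d) (e ∷ t ∷ []) z × ¬ Compatible d x z

∃Refutes⇔Refuted : ∀ d e x → (∃ λ w → Refutes d (w ∷ e ∷ x ∷ [])) ⇔ Refuted d e x
∃Refutes⇔Refuted d e x = mk⇔
  (λ (w , t , _ , z , halts , ¬c) → t , z , run-sound (φ d) w _ z halts , ¬c)
  (λ (t , z , ev , ¬c) → let n , halts = run-complete ev in
     n ⊔ t , t , s≤s (m≤n⊔m n t) , z , run-mono (φ d) _ (m≤m⊔n n t) halts , ¬c)

∀Misses⇔never : ∀ d e x → (∀ b → Misses d (b ∷ e ∷ x ∷ [])) ⇔ (∀ t → ¬ Eval (φ d) (e ∷ t ∷ []) x)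
∀Misses⇔never d e x = mk⇔
  (λ misses t ev → let n , halts = run-complete ev in
     misses (n ⊔ t) t (s≤s (m≤n⊔m n t)) (run-mono (φ d) _ (m≤m⊔n n t) halts))
  (λ never b t _ halts → never t (run-sound (φ d) b _ x halts))

¬Describes⇔ : ExcludedMiddle 0ℓ → ∀ d e x →
              (¬ Describes d e x) ⇔ (Refuted d e x ⊎ (∀ t → ¬ Eval (φ d) (e ∷ t ∷ []) x))
¬Describes⇔ lem d e x = mk⇔ forward
  λ { (inj₁ (t , z , ev , ¬c)) (_ , compatible) → ¬c (compatible t z ev)
    ; (inj₂ never) ((t , ev) , _) → never t ev }
  where
  forward : ¬ Describes d e x → Refuted d e x ⊎ (∀ t → ¬ Eval (φ d) (e ∷ t ∷ []) x)
  forward ¬D with lem {Refuted d e x}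
  ... | yes refuted = inj₁ refuted
  ... | no ¬refuted = inj₂ λ t ev → ¬D ((t , ev) , compatible)
    where
    compatible : ∀ t z → Eval (φ d) (e ∷ t ∷ []) z → Compatible d x z
    compatible t z ev with decide (Compatible-recursive d) (x ∷ z ∷ [])
    ... | yes c = c
    ... | no ¬c = ⊥-elim (¬refuted (t , z , ev , ¬c))

NotDescribed : Describer → Vec ℕ 2 → Set
NotDescribed d (e ∷ x ∷ []) = ¬ Describes d e x

NotDescribed-Σ₁∨Π₁ : ExcludedMiddle 0ℓ → ∀ d → Σ₁∨Π₁ (NotDescribed d)
NotDescribed-Σ₁∨Π₁ lem d = record
  { Σ-recursive = Refutes-recursive d ; Π-recursive = Misses-recursive d
  ; Σ⊎Π⇔ = λ { (e ∷ x ∷ []) →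
      ⇔-trans (¬Describes⇔ lem d e x) (⇔-sym (∃Refutes⇔Refuted d e x ⊎-⇔ ∀Misses⇔never d e x)) } }

2*⌊n/2⌋≤n : ∀ n → 2 * ⌊ n /2⌋ ≤ n
2*⌊n/2⌋≤n n = begin
  2 * ⌊ n /2⌋          ≡⟨ cong (⌊ n /2⌋ +_) (+-identityʳ ⌊ n /2⌋) ⟩
  ⌊ n /2⌋ + ⌊ n /2⌋    ≤⟨ +-monoʳ-≤ ⌊ n /2⌋ (⌊n/2⌋≤⌈n/2⌉ n) ⟩
  ⌊ n /2⌋ + ⌈ n /2⌉    ≡⟨ ⌊n/2⌋+⌈n/2⌉≡n n ⟩
  n                    ∎
  where open ≤-Reasoning

2^⌊log₂n⌋≤n : ∀ n → 0 < n → 2 ^ ⌊log₂ n ⌋ ≤ n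
2^⌊log₂n⌋≤n = <-rec (λ n → 0 < n → 2 ^ ⌊log₂ n ⌋ ≤ n) step
  where
  step : ∀ n → (∀ {m} → m < n → 0 < m → 2 ^ ⌊log₂ m ⌋ ≤ m) → 0 < n → 2 ^ ⌊log₂ n ⌋ ≤ n
  step 1             _  _ = ≤-refl
  step (suc (suc n)) ih _ = begin
    2 ^ ⌊log₂ (2 + n) ⌋    ≡⟨ cong (2 ^_) log-halves ⟩
    2 * 2 ^ ⌊log₂ half ⌋   ≤⟨ *-monoʳ-≤ 2 (ih (s≤s (s≤s (⌊n/2⌋≤n n))) z<s) ⟩
    2 * half               ≤⟨ 2*⌊n/2⌋≤n (2 + n) ⟩
    2 + n                  ∎
    where
    open ≤-Reasoning
    half = ⌊ 2 + n /2⌋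
    log-halves : ⌊log₂ (2 + n) ⌋ ≡ suc ⌊log₂ half ⌋
    log-halves = trans (sym (m+[n∸m]≡n (⌊log₂⌋-mono-≤ {2} {2 + n} (s≤s (s≤s z≤n)))))
                       (cong suc (sym (⌊log₂⌊n/2⌋⌋≡⌊log₂n⌋∸1 (2 + n))))

2^≤⇒≤⌊log₂⌋ : ∀ {k n} → 2 ^ k ≤ n → k ≤ ⌊log₂ n ⌋
2^≤⇒≤⌊log₂⌋ {k} {n} 2^k≤n = subst (_≤ ⌊log₂ n ⌋) (⌊log₂[2^n]⌋≡n k) (⌊log₂⌋-mono-≤ 2^k≤n)

<2^⇒⌊log₂⌋≤ : ∀ {n j} → n < 2 ^ suc j → ⌊log₂ n ⌋ ≤ j
<2^⇒⌊log₂⌋≤ {zero}      _ = z≤n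
<2^⇒⌊log₂⌋≤ {suc n} {j} n<2^j+1 with ⌊log₂ suc n ⌋ ≤? j
... | yes ≤j = ≤j
... | no  ≰j = ⊥-elim (<⇒≱ n<2^j+1 (≤-trans (^-monoʳ-≤ 2 (≰⇒> ≰j)) (2^⌊log₂n⌋≤n (suc n) z<s)))

n<2^n : ∀ n → n < 2 ^ n
n<2^n zero    = z<s
n<2^n (suc n) = begin-strict
  suc n             ≤⟨ n<2^n n ⟩
  2 ^ n             <⟨ m<m+n (2 ^ n) (≤-trans (m^n>0 2 n) (m≤m+n (2 ^ n) 0)) ⟩
  2 ^ suc n         ∎
  where open ≤-Reasoning

succ : Str → Str
succ []          = false ∷ []
succ (false ∷ s) = true ∷ s
succ (true  ∷ s) = false ∷ succ s

enc-succ : ∀ s → enc (succ s) ≡ suc (enc s)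
enc-succ []          = refl
enc-succ (false ∷ s) = refl
enc-succ (true  ∷ s) rewrite enc-succ s | *-suc 2 (enc s) = refl

decode : ℕ → Str
decode zero    = []
decode (suc n) = succ (decode n)

enc-decode : ∀ n → enc (decode n) ≡ n
enc-decode zero    = refl
enc-decode (suc n) = trans (enc-succ (decode n)) (cong suc (enc-decode n))

2^length≤1+enc : ∀ p → 2 ^ length p ≤ suc (enc p)
2^length≤1+enc []      = ≤-refl
2^length≤1+enc (b ∷ s) = ≤-trans (*-monoʳ-≤ 2 (2^length≤1+enc s)) (bit b)
  where
  bit : ∀ b → 2 * suc (enc s) ≤ suc (enc (b ∷ s))
  bit false rewrite *-suc 2 (enc s) = ≤-refl
  bit true  rewrite *-suc 2 (enc s) = n≤1+n _

2+enc≤2^1+length : ∀ p → 2 + enc p ≤ 2 ^ suc (length p)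
2+enc≤2^1+length []      = ≤-refl
2+enc≤2^1+length (b ∷ s) = ≤-trans (bit b) (*-monoʳ-≤ 2 (2+enc≤2^1+length s))
  where
  bit : ∀ b → 2 + enc (b ∷ s) ≤ 2 * (2 + enc s)
  bit false rewrite *-suc 2 (suc (enc s)) | *-suc 2 (enc s) = s≤s (s≤s (s≤s (n≤1+n _)))
  bit true  rewrite *-suc 2 (suc (enc s)) | *-suc 2 (enc s) = ≤-refl

-- enc p + 2 lies in (2 ^ length p, 2 ^ suc (length p)], so Short x (enc p) says that
-- length p < ⌊log₂ x⌋ ∸ 1 (Short-enc⇔); the doubling avoids a truncated subtraction.
Short : ℕ → ℕ → Set
Short x e = 2 * (e + 2) ≤ 2 ^ ⌊log₂ x ⌋

enc-bound⇔ : ∀ L p → 2 * (enc p + 2) ≤ 2 ^ L ⇔ length p < L ∸ 1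
enc-bound⇔ zero    p =
  mk⇔ (λ bound → ⊥-elim (<⇒≱ ≤-refl (m+n≤o⇒n≤o (enc p) (≤-trans (m≤m+n (enc p + 2) _) bound)))) (λ ())
enc-bound⇔ (suc L) p = mk⇔ forward backward
  where
  forward : 2 * (enc p + 2) ≤ 2 ^ suc L → length p < L
  forward bound with length p <? L
  ... | yes short = short
  ... | no  long  = ⊥-elim (<⇒≱ (subst (_≤ 2 ^ L) (+-comm (enc p) 2) (*-cancelˡ-≤ 2 bound))
                                 (≤-trans (^-monoʳ-≤ 2 (≮⇒≥ long)) (2^length≤1+enc p)))
  backward : length p < L → 2 * (enc p + 2) ≤ 2 ^ suc L
  backward short =
    *-monoʳ-≤ 2 (subst (_≤ 2 ^ L) (+-comm 2 (enc p)) (≤-trans (2+enc≤2^1+length p) (^-monoʳ-≤ 2 short)))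

Short-enc⇔ : ∀ x p → Short x (enc p) ⇔ length p < ⌊log₂ x ⌋ ∸ 1
Short-enc⇔ x = enc-bound⇔ ⌊log₂ x ⌋

Short⇒e+2≤2^ : ∀ x e → Short x e → e + 2 ≤ 2 ^ ⌊log₂ x ⌋
Short⇒e+2≤2^ x e short = ≤-trans (m≤m+n (e + 2) _) short

Short⇒< : ∀ x e → Short x e → e < x
Short⇒< zero    e short = ⊥-elim (<⇒≱ ≤-refl (m+n≤o⇒n≤o e (Short⇒e+2≤2^ 0 e short)))
Short⇒< (suc x) e short =
  ≤-trans (m<m+n e {2} z<s) (≤-trans (Short⇒e+2≤2^ (suc x) e short) (2^⌊log₂n⌋≤n (suc x) z<s))

Short⇔∃ : ∀ x e → Short x e ⇔ (∃ λ k → k < x × 2 * (e + 2) ≤ 2 ^ k × 2 ^ k ≤ x)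
Short⇔∃ x e = mk⇔
  (λ short → let x>0 = <-≤-trans z<s (Short⇒< x e short) ; 2^log≤x = 2^⌊log₂n⌋≤n x x>0 in
     ⌊log₂ x ⌋ , <-≤-trans (n<2^n _) 2^log≤x , short , 2^log≤x)
  (λ (k , _ , bound , 2^k≤x) → ≤-trans bound (^-monoʳ-≤ 2 (2^≤⇒≤⌊log₂⌋ {k} 2^k≤x)))

2^ᶜ : ∀ {k f} → Computable k f → Computable k (λ xs → 2 ^ f xs)
2^ᶜ {f = f} F = computable-ext (λ xs → natrec≡2^ (f xs))
  (recᶜ (constᶜ 1) (constᶜ 2 *ᶜ projᶜ (suc zero)) ∘ᶜ F ∷ᶜ []ᶜ)
  where
  natrec≡2^ : ∀ n → natrec 1 (λ _ r → 2 * r) n ≡ 2 ^ n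
  natrec≡2^ zero    = refl
  natrec≡2^ (suc n) = cong (2 *_) (natrec≡2^ n)

ShortAt : Vec ℕ 2 → Set
ShortAt (e ∷ x ∷ []) = Short x e

Short-recursive : Recursive ShortAt
Short-recursive = Recursive-⇔ (λ { (e ∷ x ∷ []) → ⇔-sym (Short⇔∃ x e) })
  (∃<ᴿ (projᶜ (suc zero)) (≤ᴿ (constᶜ 2 *ᶜ (projᶜ (suc zero) +ᶜ constᶜ 2)) (2^ᶜ (projᶜ zero)) ×ᴿ
                           ≤ᴿ (2^ᶜ (projᶜ zero)) (projᶜ (suc (suc zero)))))

NotShortlyDescribed : Describer → Vec ℕ 2 → Set
NotShortlyDescribed d v = ShortAt v → NotDescribed d v

NotShortlyDescribed-Σ₁∨Π₁ : ExcludedMiddle 0ℓ → ∀ d → Σ₁∨Π₁ (NotShortlyDescribed d)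
NotShortlyDescribed-Σ₁∨Π₁ lem d = Σ₁∨Π₁-→ Short-recursive (NotDescribed-Σ₁∨Π₁ lem d)

NoShortDescription : Describer → ℕ → Set
NoShortDescription d x = ∀ e → Short x e → ¬ Describes d e x

NoShortDescription³ : Describer → Describer → Describer → ℕ → Set
NoShortDescription³ d₁ d₂ d₃ x = NoShortDescription d₁ x × NoShortDescription d₂ x × NoShortDescription d₃ x

KGe⇔NoShortDescription : ∀ {d f} → Represents d f → ∀ x → KGe f x (⌊log₂ x ⌋ ∸ 1) ⇔ NoShortDescription d x
KGe⇔NoShortDescription {d} {f} d≈f x = mk⇔
  (λ long e short D → let p = decode e ; e≡enc = sym (enc-decode e) in
     <⇒≱ (to (Short-enc⇔ x p) (subst (Short x) e≡enc short))
         (long p (to (describes⇔ d≈f p x) (subst (λ e → Describes d e x) e≡enc D))))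
  (λ none p fpx → ≮⇒≥ λ short → none (enc p) (from (Short-enc⇔ x p) short) (from (describes⇔ d≈f p x) fpx))

NoShortDescription-Δ₂Form : ExcludedMiddle 0ℓ → ∀ d → Δ₂Form (λ xs → NoShortDescription d (lookup xs zero))
NoShortDescription-Δ₂Form lem d = Δ₂Form-⇔ (λ { (x ∷ []) → bounded⇔ x })
  (Δ₂Form-∀< (projᶜ zero) (Σ₁∨Π₁⇒Δ₂Form lem (NotShortlyDescribed-Σ₁∨Π₁ lem d)))
  where
  bounded⇔ : ∀ x → (∀ e → e < x → Short x e → ¬ Describes d e x) ⇔ NoShortDescription d x
  bounded⇔ x = mk⇔ (λ none e short → none e (Short⇒< x e short) short) (λ none e _ → none e)

NoShortDescription³-Δ₂Form : ExcludedMiddle 0ℓ → ∀ d₁ d₂ d₃ →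
                             Δ₂Form (λ xs → NoShortDescription³ d₁ d₂ d₃ (lookup xs zero))
NoShortDescription³-Δ₂Form lem d₁ d₂ d₃ =
  Δ₂Form-× (NoShortDescription-Δ₂Form lem d₁)
           (Δ₂Form-× (NoShortDescription-Δ₂Form lem d₂) (NoShortDescription-Δ₂Form lem d₃))

NotShortDescription : Describer → ℕ → Str → Set
NotShortDescription d x p = Short x (enc p) → ¬ Describes d (enc p) x

-- The second string only selects whether d or d′ is checked, so that a single Σ⁰₁ ∨ Π⁰₁
-- relation covers two describers.
CheckOneOf : Describer → Describer → Rel 2
CheckOneOf d d′ x (p ∷ s ∷ []) = Cases (0 < enc s) (NotShortDescription d′ x p) (NotShortDescription d x p)

CheckOnly : Describer → Rel 2
CheckOnly d x (p ∷ _ ∷ []) = NotShortDescription d x p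

swap₂ᶜ : Computables 3 2 (λ v → lookup v (suc zero) ∷ lookup v zero ∷ [])
swap₂ᶜ = projᶜ (suc zero) ∷ᶜ projᶜ zero ∷ᶜ []ᶜ

CheckOneOf-IsΣ∨Π : ExcludedMiddle 0ℓ → ∀ d d′ → IsΣ∨Π (CheckOneOf d d′)
CheckOneOf-IsΣ∨Π lem d d′ = Σ₁∨Π₁⇒IsΣ∨Π
  (Σ₁∨Π₁-cases (posᴿ (projᶜ (suc (suc zero))))
               (Σ₁∨Π₁-∘ (NotShortlyDescribed-Σ₁∨Π₁ lem d′) swap₂ᶜ) (Σ₁∨Π₁-∘ (NotShortlyDescribed-Σ₁∨Π₁ lem d) swap₂ᶜ))
  (λ { x (p ∷ s ∷ []) → ⇔-id _ })

CheckOnly-IsΣ∨Π : ExcludedMiddle 0ℓ → ∀ d → IsΣ∨Π (CheckOnly d)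
CheckOnly-IsΣ∨Π lem d =
  Σ₁∨Π₁⇒IsΣ∨Π (Σ₁∨Π₁-∘ (NotShortlyDescribed-Σ₁∨Π₁ lem d) swap₂ᶜ) (λ { x (p ∷ s ∷ []) → ⇔-id _ })

NoShortDescription⇐ : ∀ {d x} → (∀ p → length p < ⌊log₂ x ⌋ ∸ 1 → NotShortDescription d x p) →
                      NoShortDescription d x
NoShortDescription⇐ {d} {x} check e short described =
  check (decode e) (to (Short-enc⇔ x (decode e)) short′) short′ (subst (λ e → Describes d e x) e≡enc described)
  where
  e≡enc : e ≡ enc (decode e)
  e≡enc = sym (enc-decode e)
  short′ : Short x (enc (decode e))
  short′ = subst (Short x) e≡enc short

NoShortDescription³⇔strings : ∀ d₁ d₂ d₃ x →
  NoShortDescription³ d₁ d₂ d₃ x ⇔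
  (∀ (vs : Vec Str 2) → All (λ v → length v ≤ ⌊log₂ x ⌋) vs → CheckOneOf d₁ d₃ x vs × CheckOnly d₂ x vs)
NoShortDescription³⇔strings d₁ d₂ d₃ x = mk⇔
  (λ { (none₁ , none₂ , none₃) (p ∷ s ∷ []) _ → ((λ _ → none₃ (enc p)) , (λ _ → none₁ (enc p))) , none₂ (enc p) })
  (λ checks →
    NoShortDescription⇐ {d₁} (λ p short → proj₂ (proj₁ (checks (p ∷ [] ∷ []) (fits short ∷ z≤n ∷ []))) (λ ())) ,
    NoShortDescription⇐ {d₂} (λ p short → proj₂ (checks (p ∷ [] ∷ []) (fits short ∷ z≤n ∷ []))) ,
    NoShortDescription⇐ {d₃} (λ p short →
      proj₁ (proj₁ (checks (p ∷ (true ∷ []) ∷ []) (fits short ∷ 1≤log short ∷ []))) z<s))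
  where
  fits : ∀ {m} → m < ⌊log₂ x ⌋ ∸ 1 → m ≤ ⌊log₂ x ⌋
  fits m<L∸1 = ≤-trans (<⇒≤ m<L∸1) (m∸n≤m ⌊log₂ x ⌋ 1)
  1≤log : ∀ {m} → m < ⌊log₂ x ⌋ ∸ 1 → 1 ≤ ⌊log₂ x ⌋
  1≤log m<L∸1 = ≤-trans (≤-trans (s≤s z≤n) m<L∸1) (m∸n≤m ⌊log₂ x ⌋ 1)

InI⇔NoShortDescription³ : ∀ {U Vmax Vmin d₁ d₂ d₃} → Represents d₁ U → Represents d₂ Vmax → Represents d₃ Vmin →
  ∀ x → InI U Vmax Vmin x ⇔ NoShortDescription³ d₁ d₂ d₃ x
InI⇔NoShortDescription³ r₁ r₂ r₃ x =
  KGe⇔NoShortDescription r₁ x ×-⇔ KGe⇔NoShortDescription r₂ x ×-⇔ KGe⇔NoShortDescription r₃ x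

-- Counting

functional-codes-bound : ∀ {k} M N L (D : Fin k → ℕ → ℕ → Set) → (∀ j {e x x′} → D j e x → D j e x′ → x ≡ x′) →
                         (∀ i → i < N → Σ (Fin k) λ j → ∃ λ e → e < M × D j e (L + i)) → N ≤ k * M
functional-codes-bound {k} M N L D functional coded = injective⇒≤ {f = code} code-injective
  where
  Coded : ℕ → Set
  Coded x = Σ (Fin k) λ j → ∃ λ e → e < M × D j e x
  code-of : ∀ {x} → Coded x → Fin (k * M)
  code-of (j , e , e<M , _) = combine j (fromℕ< e<M)
  code : Fin N → Fin (k * M)
  code i = code-of (coded (toℕ i) (toℕ<n i))
  same-code : ∀ {x x′} (c : Coded x) (c′ : Coded x′) → code-of c ≡ code-of c′ → x ≡ x′
  same-code (j , e , e<M , d) (j′ , e′ , e′<M , d′) eq with combine-injective j (fromℕ< e<M) j′ (fromℕ< e′<M) eq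
  ... | refl , fromℕ<≡ with trans (sym (toℕ-fromℕ< e<M)) (trans (cong toℕ fromℕ<≡) (toℕ-fromℕ< e′<M))
  ...   | refl = functional j d d′
  code-injective : ∀ {i i′} → code i ≡ code i′ → i ≡ i′
  code-injective {i} {i′} eq =
    toℕ-injective (+-cancelˡ-≡ L _ _ (same-code (coded (toℕ i) (toℕ<n i)) (coded (toℕ i′) (toℕ<n i′)) eq))

short-description-bound : ∀ {n x e} → x < 2 ^ suc (suc n) → Short x e → e < pred (2 ^ n)
short-description-bound {n} {x} {e} x<2^n+2 short = <⇒≤pred (subst (_≤ 2 ^ n) (+-comm e 2) (*-cancelˡ-≤ 2 (begin
  2 * (e + 2)          ≤⟨ short ⟩
  2 ^ ⌊log₂ x ⌋        ≤⟨ ^-monoʳ-≤ 2 (<2^⇒⌊log₂⌋≤ {x} {suc n} x<2^n+2) ⟩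
  2 ^ suc n            ∎)))
  where open ≤-Reasoning

2^n+i<2^[2+n] : ∀ n {i} → i < 3 * 2 ^ n → 2 ^ n + i < 2 ^ suc (suc n)
2^n+i<2^[2+n] n {i} i<3*2^n = subst (2 ^ n + i <_) (four-fold (2 ^ n)) (+-monoʳ-< (2 ^ n) i<3*2^n)
  where
  four-fold : ∀ m → m + 3 * m ≡ 2 * (2 * m)
  four-fold = solve-∀

NoShortDescription³-infinite : ExcludedMiddle 0ℓ → ∀ d₁ d₂ d₃ → Infinite (NoShortDescription³ d₁ d₂ d₃)
NoShortDescription³-infinite lem d₁ d₂ d₃ n with lem {∃ λ x → n ≤ x × NoShortDescription³ d₁ d₂ d₃ x}
... | yes found = found
... | no  none  = ⊥-elim (<⇒≱ (*-monoʳ-< 3 pred[2^n]<2^n)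
  (functional-codes-bound (pred (2 ^ n)) (3 * 2 ^ n) (2 ^ n) (Describes ∘ ds) (Describes-functional ∘ ds) coded))
  where
  ds : Fin 3 → Describer
  ds = lookup (d₁ ∷ d₂ ∷ d₃ ∷ [])
  pred[2^n]<2^n : pred (2 ^ n) < 2 ^ n
  pred[2^n]<2^n = m≤pred[n]⇒suc[m]≤n {{m^n≢0 2 n}} ≤-refl
  some-describer : ∀ x → ¬ NoShortDescription³ d₁ d₂ d₃ x → Σ (Fin 3) λ j → ¬ NoShortDescription (ds j) x
  some-describer x ¬all
    with lem {NoShortDescription d₁ x} | lem {NoShortDescription d₂ x} | lem {NoShortDescription d₃ x}
  ... | no ¬none₁ | _         | _         = zero , ¬none₁
  ... | yes _     | no ¬none₂ | _         = suc zero , ¬none₂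
  ... | yes _     | yes _     | no ¬none₃ = suc (suc zero) , ¬none₃
  ... | yes none₁ | yes none₂ | yes none₃ = ⊥-elim (¬all (none₁ , none₂ , none₃))
  short-description : ∀ d x → ¬ NoShortDescription d x → ∃ λ e → Short x e × Describes d e x
  short-description d x ¬none with lem {∃ λ e → Short x e × Describes d e x}
  ... | yes found  = found
  ... | no  ¬found = ⊥-elim (¬none λ e short described → ¬found (e , short , described))
  coded : ∀ i → i < 3 * 2 ^ n → Σ (Fin 3) λ j → ∃ λ e → e < pred (2 ^ n) × Describes (ds j) e (2 ^ n + i)
  coded i i<3*2^n
    with some-describer (2 ^ n + i) (λ good → none (2 ^ n + i , ≤-trans (<⇒≤ (n<2^n n)) (m≤m+n _ i) , good))
  ... | j , ¬none with short-description (ds j) (2 ^ n + i) ¬none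
  ...   | e , short , described = j , e , short-description-bound {n} (2^n+i<2^[2+n] n i<3*2^n) short , described

mainTheorem11 : ExcludedMiddle 0ℓ →
    (U Vmax Vmin : PFun) →
    Optimal IsPR U → Optimal IsMaxPR Vmax → Optimal IsMinPR Vmin →
    Infinite (InI U Vmax Vmin) × DefForallLog (InI U Vmax Vmin) × IsΔ2 (InI U Vmax Vmin)
mainTheorem11 lem U Vmax Vmin (U-PR , _) (Vmax-MaxPR , _) (Vmin-MinPR , _) = infinite , definable , Δ₂
  where
  d₁ d₂ d₃ : Describer
  d₁ = describer-PR (proj₁ U-PR)
  d₂ = describer-max (proj₁ Vmax-MaxPR)
  d₃ = describer-min (proj₁ Vmin-MinPR)
  InI⇔ : ∀ x → InI U Vmax Vmin x ⇔ NoShortDescription³ d₁ d₂ d₃ x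
  InI⇔ = InI⇔NoShortDescription³ (IsPR⇒Represents U-PR) (IsMaxPR⇒Represents Vmax-MaxPR)
                                 (IsMinPR⇒Represents Vmin-MinPR)
  infinite : Infinite (InI U Vmax Vmin)
  infinite n with NoShortDescription³-infinite lem d₁ d₂ d₃ n
  ... | x , n≤x , none = x , n≤x , from (InI⇔ x) none
  definable : DefForallLog (InI U Vmax Vmin)
  definable = 2 , CheckOneOf d₁ d₃ , CheckOnly d₂ , CheckOneOf-IsΣ∨Π lem d₁ d₃ , CheckOnly-IsΣ∨Π lem d₂ ,
              λ x → ⇔-trans (InI⇔ x) (NoShortDescription³⇔strings d₁ d₂ d₃ x)
  Δ₂ : IsΔ2 (InI U Vmax Vmin)
  Δ₂ = Δ₂Form⇒IsΔ2 (Δ₂Form-⇔ {Q = λ xs → InI U Vmax Vmin (lookup xs zero)} (λ { (x ∷ []) → ⇔-sym (InI⇔ x) })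
                                (NoShortDescription³-Δ₂Form lem d₁ d₂ d₃))
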